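{- Let $n$ be odd and $m>1$, and let $G=S_n\wr S_m$ in its imprimitive action on $nm$ points. Then each of $-1,-2,\dots,-n$ is a root of $F_G(x)$.
   Context: $F_G(x)=\sum_{g\in G}x^{c(g)}$, where $c(g)$ is the number of cycles of $g$ (including fixed points). The imprimitive action of $S_n\wr S_m$ is on $m$ copies of $\{1,\dots,n\}$, with the base group $S_n^m$ acting coordinatewise and $S_m$ permuting the copies. -}

module Defs where

open import Data.Nat as ℕ using (ℕ; zero; suc; _≤_; _≤?_; _<_)
open import Data.Fin using (Fin; toℕ)
open import Data.Fin.Properties using (_≟_)
open import Data.List using (List; []; _∷_; map; concatMap; filter; length; allFin; upTo; cartesianProduct)
open import Data.Vec as Vec using (Vec; []; _∷_; lookup; toList)
open import Data.Product using (_×_; _,_)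
open import Data.Integer as ℤ using (ℤ)
open import Data.List.Relation.Unary.All using (All; all?)
import Data.List.Relation.Unary.Unique.DecPropositional as UniqueDec
open import Function using (_∘_)

vecsFrom : {A : Set} → List A → (k : ℕ) → List (Vec A k)
vecsFrom xs zero    = [] ∷ []
vecsFrom xs (suc k) = concatMap (λ v → map (_∷ v) xs) (vecsFrom xs k)

-- A permutation of Fin n is represented by its table of values
-- (σ(0), …, σ(n-1)), a vector with pairwise distinct entries.
Perm : ℕ → Set
Perm n = Vec (Fin n) n

symGroup : (n : ℕ) → List (Perm n)
symGroup n = filter (λ v → UniqueDec.unique? _≟_ (toList v)) (vecsFrom (allFin n) n)

-- An element of the wreath product S_n ≀ S_m: a permutation σ ∈ S_m of the
-- copies together with a tuple (f_1, …, f_m) ∈ S_n^m.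
Wreath : ℕ → ℕ → Set
Wreath n m = Perm m × Vec (Perm n) m

wreathGroup : (n m : ℕ) → List (Wreath n m)
wreathGroup n m = concatMap (λ σ → map (σ ,_) (vecsFrom (symGroup n) m)) (symGroup m)

-- The imprimitive action on the n·m points (i , j) ∈ Fin m × Fin n
-- (point j of copy i):  (σ , f) · (i , j) = (σ(i) , f_i(j)).
act : {n m : ℕ} → Wreath n m → Fin m × Fin n → Fin m × Fin n
act (σ , f) (i , j) = lookup σ i , lookup (lookup f i) j

iter : {A : Set} → (A → A) → ℕ → A → A
iter g zero    x = x
iter g (suc k) x = g (iter g k x)

key : {n m : ℕ} → Fin m × Fin n → ℕ
key {n} (i , j) = toℕ i ℕ.* n ℕ.+ toℕ j

-- A point is the leader of its cycle if it is the key-minimal point of its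
-- orbit {g^k(p) : k < nm}.  Every cycle has exactly one leader.
isLeader : {n m : ℕ} → Wreath n m → Fin m × Fin n → Set
isLeader {n} {m} g p = All (λ k → key p ≤ key (iter (act g) k p)) (upTo (m ℕ.* n))

cycles : {n m : ℕ} → Wreath n m → ℕ
cycles {n} {m} g =
  length (filter (λ p → all? (λ k → key p ≤? key (iter (act g) k p)) (upTo (m ℕ.* n)))
                 (cartesianProduct (allFin m) (allFin n)))

sumℤ : List ℤ → ℤ
sumℤ []       = ℤ.0ℤ
sumℤ (x ∷ xs) = x ℤ.+ sumℤ xs

F-wreath : (n m : ℕ) → ℤ → ℤ
F-wreath n m x = sumℤ (map (λ g → x ℤ.^ cycles g) (wreathGroup n m))

open import Data.Product using (∃)
open import Relation.Binary.PropositionalEquality using (_≡_)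
IsOdd : ℕ → Set
IsOdd n = ∃ λ t → n ≡ suc (2 ℕ.* t)

-- Write W_m(x) = F_{S_n ≀ S_m}(x).  An element of S_n ≀ S_{m+1} is determined by the copy c
-- that the last copy is sent to, the permutation h ∈ S_n by which it acts, and the element of
-- S_n ≀ S_m obtained by contracting the last copy: the copy that was sent to the last copy is
-- now sent straight to c, acting by h after its own permutation.  Contraction loses no cycle,
-- except the cycles of h when c is the last copy itself, and for fixed c and h it is a
-- bijection onto S_n ≀ S_m.  Hence W_{m+1}(x) = (F_{S_n}(x) + m·n!) · W_m(x).  Since
-- S_1 ≀ S_m = S_m, this gives F_{S_m}(x) = x(x+1)⋯(x+m-1), so F_{S_n}(-k) = 0 for k < n, and
-- F_{S_n}(-n) = (-1)ⁿ n! = -n! for odd n.  For m ≥ 2 both factors F_{S_n}(x) and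
-- F_{S_n}(x) + n! divide W_m(x), and between them they vanish at x = -1, …, -n.
module Submission where

open import Defs
open import Data.Nat using (ℕ; _≤_; _<_)
open import Data.Integer using (-_; +_; 0ℤ)
open import Relation.Binary.PropositionalEquality using (_≡_)

-- Cycles of a permutation g of {0,…,N-1}, given as a self-map of ℕ, counted by their
-- key-minimal points, exactly as `cycles` counts them.
module CycleCount where

  open import Data.Nat
  open import Data.Nat.Properties
  open import Data.Fin using (Fin; fromℕ<; toℕ)
  import Data.Fin.Properties as Fin
  open import Data.List using (List; []; _∷_; upTo; filter; length; _++_; [_])
  open import Data.List.Properties using (length-++; filter-++; upTo-∷ʳ)
  open import Data.List.Relation.Unary.All as All using (All; all?; []; _∷_)
  open import Data.List.Membership.Propositional.Properties using (∈-upTo⁺; ∈-upTo⁻)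
  open import Relation.Binary.PropositionalEquality hiding ([_])
  open import Relation.Nullary
  open import Data.Product using (∃; _×_; _,_; proj₁; proj₂)
  open import Data.Sum using (_⊎_; inj₁; inj₂)
  open import Data.Empty using (⊥; ⊥-elim)
  open import Function using (_⇔_; mk⇔; Equivalence)

  IsLeader : ℕ → (ℕ → ℕ) → ℕ → Set
  IsLeader N g p = All (λ k → p ≤ iter g k p) (upTo N)

  isLeader? : (N : ℕ) (g : ℕ → ℕ) (p : ℕ) → Dec (IsLeader N g p)
  isLeader? N g p = all? (λ k → p ≤? iter g k p) (upTo N)

  cycleCount : ℕ → (ℕ → ℕ) → ℕ
  cycleCount N g = length (filter (isLeader? N g) (upTo N))

  IsPermBelow : ℕ → (ℕ → ℕ) → Set
  IsPermBelow N g = (∀ {x} → x < N → g x < N) × (∀ {x y} → x < N → y < N → g x ≡ g y → x ≡ y)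

  indicator : ∀ {a} {A : Set a} → Dec A → ℕ
  indicator (yes _) = 1
  indicator (no _)  = 0

  indicator-cong : ∀ {A B : Set} (a? : Dec A) (b? : Dec B) → A ⇔ B → indicator a? ≡ indicator b?
  indicator-cong (yes _) (yes _) _   = refl
  indicator-cong (yes a) (no ¬b) a⇔b = ⊥-elim (¬b (Equivalence.to a⇔b a))
  indicator-cong (no ¬a) (yes b) a⇔b = ⊥-elim (¬a (Equivalence.from a⇔b b))
  indicator-cong (no _)  (no _)  _   = refl

  case-dec : ∀ {a b} {A : Set a} {B : Set b} → Dec A → (A → B) → (¬ A → B) → B
  case-dec (yes a) f _ = f a
  case-dec (no ¬a) _ g = g ¬a

  length-filter-cong : ∀ {A : Set} {P Q : A → Set} (P? : ∀ x → Dec (P x)) (Q? : ∀ x → Dec (Q x))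
                       (xs : List A) → All (λ x → P x ⇔ Q x) xs →
                       length (filter P? xs) ≡ length (filter Q? xs)
  length-filter-cong P? Q? []       []         = refl
  length-filter-cong P? Q? (x ∷ xs) (px⇔qx ∷ hs) with P? x | Q? x
  ... | yes _  | yes _ = cong suc (length-filter-cong P? Q? xs hs)
  ... | yes px | no ¬q = ⊥-elim (¬q (Equivalence.to px⇔qx px))
  ... | no ¬p  | yes q = ⊥-elim (¬p (Equivalence.from px⇔qx q))
  ... | no _   | no _  = length-filter-cong P? Q? xs hs

  length-filter-[_] : ∀ {A : Set} {P : A → Set} (P? : ∀ x → Dec (P x)) x →
                      length (filter P? [ x ]) ≡ indicator (P? x)
  length-filter-[_] P? x with P? x
  ... | yes _ = refl
  ... | no _  = refl

  all-<-upTo : ∀ N → All (_< N) (upTo N)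
  all-<-upTo N = All.tabulate ∈-upTo⁻

  iter-+ : (g : ℕ → ℕ) (a b x : ℕ) → iter g (a + b) x ≡ iter g a (iter g b x)
  iter-+ g zero    b x = refl
  iter-+ g (suc a) b x = cong g (iter-+ g a b x)

  module _ {N : ℕ} {g : ℕ → ℕ} (g-perm : IsPermBelow N g) where

    iter-< : ∀ k {x} → x < N → iter g k x < N
    iter-< zero    x<N = x<N
    iter-< (suc k) x<N = proj₁ g-perm (iter-< k x<N)

    iter-injective : ∀ k {x y} → x < N → y < N → iter g k x ≡ iter g k y → x ≡ y
    iter-injective zero    _   _   eq = eq
    iter-injective (suc k) x<N y<N eq =
      iter-injective k x<N y<N (proj₂ g-perm (iter-< k x<N) (iter-< k y<N) eq)

    -- By pigeonhole two of p, g p, …, gᴺ p coincide, and injectivity cancels the earlier one.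
    period : ∀ {p} → p < N → ∃ λ d → 0 < d × d ≤ N × iter g d p ≡ p
    period {p} p<N with Fin.pigeonhole (n<1+n N) (λ (i : Fin (suc N)) → fromℕ< (iter-< (toℕ i) p<N))
    ... | i , j , i<j , gⁱp≡gʲp =
      toℕ j ∸ toℕ i , m<n⇒0<n∸m i<j , ≤-trans (m∸n≤m (toℕ j) (toℕ i)) (≤-pred (Fin.toℕ<n j)) ,
      sym (iter-injective (toℕ i) p<N (iter-< (toℕ j ∸ toℕ i) p<N) (trans same split))
      where
      same : iter g (toℕ i) p ≡ iter g (toℕ j) p
      same = Fin.fromℕ<-injective _ _ (iter-< (toℕ i) p<N) (iter-< (toℕ j) p<N) gⁱp≡gʲp
      split : iter g (toℕ j) p ≡ iter g (toℕ i) (iter g (toℕ j ∸ toℕ i) p)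
      split = trans (cong (λ z → iter g z p) (sym (trans (+-comm (toℕ i) _) (m∸n+n≡m (<⇒≤ i<j)))))
                    (iter-+ g (toℕ i) (toℕ j ∸ toℕ i) p)

    orbit-below : ∀ {p} → p < N → ∀ k → ∃ λ j → j < N × iter g k p ≡ iter g j p
    orbit-below {p} p<N k with period p<N
    ... | d , 0<d , d≤N , gᵈp≡p with reduce k
      where
      reduce : ∀ k → ∃ λ j → j < d × iter g k p ≡ iter g j p
      reduce zero = 0 , 0<d , refl
      reduce (suc k) with reduce k
      ... | j , j<d , eq with suc j <? d
      ...   | yes 1+j<d = suc j , 1+j<d , cong g eq
      ...   | no 1+j≮d  = 0 , 0<d ,
                trans (cong g eq) (trans (cong (λ z → iter g z p) (≤-antisym j<d (≮⇒≥ 1+j≮d))) gᵈp≡p)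
    ... | j , j<d , eq = j , <-≤-trans j<d d≤N , eq

    leader⇒≤-orbit : ∀ {p} → p < N → IsLeader N g p → ∀ k → p ≤ iter g k p
    leader⇒≤-orbit p<N leader k with orbit-below p<N k
    ... | j , j<N , eq = subst (_ ≤_) (sym eq) (All.lookup leader (∈-upTo⁺ j<N))

  ≤-orbit⇒leader : ∀ {N g p} → (∀ k → p ≤ iter g k p) → IsLeader N g p
  ≤-orbit⇒leader p≤ = All.tabulate (λ {k} _ → p≤ k)

  cycleCount-cong : ∀ {N g g′} → IsPermBelow N g → (∀ {x} → x < N → g x ≡ g′ x) →
                    cycleCount N g ≡ cycleCount N g′
  cycleCount-cong {N} {g} {g′} g-perm g≗g′ =
    length-filter-cong _ _ (upTo N) (All.map same-leaders (all-<-upTo N))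
    where
    iter-≗ : ∀ k {p} → p < N → iter g k p ≡ iter g′ k p
    iter-≗ zero    _   = refl
    iter-≗ (suc k) p<N = trans (g≗g′ (iter-< g-perm k p<N)) (cong g′ (iter-≗ k p<N))
    same-leaders : ∀ {p} → p < N → IsLeader N g p ⇔ IsLeader N g′ p
    same-leaders p<N = mk⇔ (All.map (λ {k} → subst (_ ≤_) (iter-≗ k p<N)))
                           (All.map (λ {k} → subst (_ ≤_) (sym (iter-≗ k p<N))))

  -- contract N g removes the point N from its cycle.
  contract : ℕ → (ℕ → ℕ) → ℕ → ℕ
  contract N g x with g x ≟ N
  ... | yes _ = g N
  ... | no _  = g x

  contract-hit : ∀ N g x → g x ≡ N → contract N g x ≡ g N
  contract-hit N g x gx≡N with g x ≟ N
  ... | yes _    = refl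
  ... | no gx≢N = ⊥-elim (gx≢N gx≡N)

  contract-miss : ∀ N g x → g x ≢ N → contract N g x ≡ g x
  contract-miss N g x gx≢N with g x ≟ N
  ... | yes gx≡N = ⊥-elim (gx≢N gx≡N)
  ... | no _     = refl

  contract-isPermBelow : ∀ {N g} → IsPermBelow (suc N) g → IsPermBelow N (contract N g)
  contract-isPermBelow {N} {g} (g-< , g-inj) = bounded , injective
    where
    <⇒<1+ : ∀ {x} → x < N → x < suc N
    <⇒<1+ = m≤n⇒m≤1+n
    ≡N⇒≮N : ∀ {x} → x ≡ N → x < N → ⊥
    ≡N⇒≮N refl = <-irrefl refl
    bounded : ∀ {x} → x < N → contract N g x < N
    bounded {x} x<N with g x ≟ N
    ... | yes gx≡N = ≤∧≢⇒< (≤-pred (g-< (n<1+n N)))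
                           (λ gN≡N → ≡N⇒≮N (g-inj (<⇒<1+ x<N) (n<1+n N) (trans gx≡N (sym gN≡N))) x<N)
    ... | no gx≢N  = ≤∧≢⇒< (≤-pred (g-< (<⇒<1+ x<N))) gx≢N
    injective : ∀ {x y} → x < N → y < N → contract N g x ≡ contract N g y → x ≡ y
    injective {x} {y} x<N y<N eq with g x ≟ N | g y ≟ N
    ... | yes gx≡N | yes gy≡N = g-inj (<⇒<1+ x<N) (<⇒<1+ y<N) (trans gx≡N (sym gy≡N))
    ... | yes _    | no _     = ⊥-elim (≡N⇒≮N (sym (g-inj (n<1+n N) (<⇒<1+ y<N) eq)) y<N)
    ... | no _     | yes _    = ⊥-elim (≡N⇒≮N (g-inj (<⇒<1+ x<N) (n<1+n N) eq) x<N)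
    ... | no _     | no _     = g-inj (<⇒<1+ x<N) (<⇒<1+ y<N) eq

  -- Away from N the orbits of g and of contract N g visit the same points.
  module _ (N : ℕ) (g : ℕ → ℕ) (p : ℕ) (p<N : p < N) where
    private h = contract N g

    orbit-contract⊇orbit : ∀ k → (∃ λ k′ → iter g k p ≡ iter h k′ p)
                                ⊎ (iter g k p ≡ N × ∃ λ k′ → g (iter h k′ p) ≡ N)
    orbit-contract⊇orbit zero = inj₁ (0 , refl)
    orbit-contract⊇orbit (suc k) with orbit-contract⊇orbit k
    ... | inj₂ (gᵏp≡N , k′ , hit) = inj₁ (suc k′ , trans (cong g gᵏp≡N) (sym (contract-hit N g _ hit)))
    ... | inj₁ (k′ , eq) = case-dec (g (iter h k′ p) ≟ N)
            (λ hit  → inj₂ (trans (cong g eq) hit , k′ , hit))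
            (λ miss → inj₁ (suc k′ , trans (cong g eq) (sym (contract-miss N g _ miss))))

    orbit⊇orbit-contract : ∀ k′ → ∃ λ k → iter h k′ p ≡ iter g k p
    orbit⊇orbit-contract zero = 0 , refl
    orbit⊇orbit-contract (suc k′) with orbit⊇orbit-contract k′
    ... | k , eq = case-dec (g (iter h k′ p) ≟ N)
            (λ hit  → suc (suc k) , trans (contract-hit N g _ hit) (cong g (trans (sym hit) (cong g eq))))
            (λ miss → suc k , trans (contract-miss N g _ miss) (cong g eq))

    ≤-orbit-contract⇒≤-orbit : (∀ k → p ≤ iter h k p) → ∀ k → p ≤ iter g k p
    ≤-orbit-contract⇒≤-orbit p≤ k with orbit-contract⊇orbit k
    ... | inj₁ (k′ , eq)   = subst (p ≤_) (sym eq) (p≤ k′)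
    ... | inj₂ (gᵏp≡N , _) = subst (p ≤_) (sym gᵏp≡N) (<⇒≤ p<N)

    ≤-orbit⇒≤-orbit-contract : (∀ k → p ≤ iter g k p) → ∀ k → p ≤ iter h k p
    ≤-orbit⇒≤-orbit-contract p≤ k′ with orbit⊇orbit-contract k′
    ... | k , eq = subst (p ≤_) (sym eq) (p≤ k)

  top-leader⇔fixed : ∀ {N g} → IsPermBelow (suc N) g → IsLeader (suc N) g N ⇔ (g N ≡ N)
  top-leader⇔fixed {N} {g} (g-< , _) = mk⇔ (fixed N g-<) (λ gN≡N → ≤-orbit⇒leader (λ k → ≤-reflexive (sym (stays k gN≡N))))
    where
    fixed : ∀ N → (∀ {x} → x < suc N → g x < suc N) → IsLeader (suc N) g N → g N ≡ N
    fixed zero     g-< _      = n<1⇒n≡0 (g-< (n<1+n 0))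
    fixed (suc N′) g-< leader = ≤-antisym (≤-pred (g-< (n<1+n (suc N′))))
                                          (All.lookup leader (∈-upTo⁺ {i = 1} (s≤s (s≤s z≤n))))
    stays : ∀ k → g N ≡ N → iter g k N ≡ N
    stays zero    _     = refl
    stays (suc k) gN≡N = trans (cong g (stays k gN≡N)) gN≡N

  cycleCount-contract : ∀ {N g} → IsPermBelow (suc N) g →
                        cycleCount (suc N) g ≡ cycleCount N (contract N g) + indicator (g N ≟ N)
  cycleCount-contract {N} {g} g-perm = begin
      cycleCount (suc N) g
    ≡⟨ cong (λ ps → length (filter leader? ps)) (sym (upTo-∷ʳ N)) ⟩
      length (filter leader? (upTo N ++ [ N ]))
    ≡⟨ cong length (filter-++ leader? (upTo N) [ N ]) ⟩
      length (filter leader? (upTo N) ++ filter leader? [ N ])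
    ≡⟨ length-++ (filter leader? (upTo N)) ⟩
      length (filter leader? (upTo N)) + length (filter leader? [ N ])
    ≡⟨ cong₂ _+_ (length-filter-cong _ _ (upTo N) (All.map same-leaders (all-<-upTo N)))
                 (length-filter-[ leader? ] N) ⟩
      cycleCount N (contract N g) + indicator (leader? N)
    ≡⟨ cong (λ z → cycleCount N (contract N g) + z) (indicator-cong _ _ (top-leader⇔fixed g-perm)) ⟩
      cycleCount N (contract N g) + indicator (g N ≟ N)
    ∎
    where
    open ≡-Reasoning
    leader? = isLeader? (suc N) g
    same-leaders : ∀ {p} → p < N → IsLeader (suc N) g p ⇔ IsLeader N (contract N g) p
    same-leaders p<N = mk⇔
      (λ leader → ≤-orbit⇒leader (≤-orbit⇒≤-orbit-contract N g _ p<N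
                    (leader⇒≤-orbit g-perm (m≤n⇒m≤1+n p<N) leader)))
      (λ leader → ≤-orbit⇒leader (≤-orbit-contract⇒≤-orbit N g _ p<N
                    (leader⇒≤-orbit (contract-isPermBelow g-perm) p<N leader)))

  -- Contract the points M + t - 1, …, M + 1, M in turn; cyclesAbove counts the cycles of g
  -- removed on the way, i.e. those lying inside [M, M + t).
  contractAbove : ℕ → ℕ → (ℕ → ℕ) → ℕ → ℕ
  contractAbove M zero    g = g
  contractAbove M (suc t) g = contractAbove M t (contract (M + t) g)

  cyclesAbove : ℕ → ℕ → (ℕ → ℕ) → ℕ
  cyclesAbove M zero    g = 0
  cyclesAbove M (suc t) g = cyclesAbove M t (contract (M + t) g) + indicator (g (M + t) ≟ M + t)

  cycleCount-split : ∀ M t g → IsPermBelow (M + t) g →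
                     cycleCount (M + t) g ≡ cycleCount M (contractAbove M t g) + cyclesAbove M t g
  cycleCount-split M zero g _ = trans (cong (λ z → cycleCount z g) (+-identityʳ M)) (sym (+-identityʳ _))
  cycleCount-split M (suc t) g g-perm = begin
      cycleCount (M + suc t) g
    ≡⟨ cong (λ z → cycleCount z g) (+-suc M t) ⟩
      cycleCount (suc (M + t)) g
    ≡⟨ cycleCount-contract g-perm′ ⟩
      cycleCount (M + t) g′ + fixed
    ≡⟨ cong (_+ fixed) (cycleCount-split M t g′ (contract-isPermBelow g-perm′)) ⟩
      cycleCount M (contractAbove M t g′) + cyclesAbove M t g′ + fixed
    ≡⟨ +-assoc (cycleCount M (contractAbove M t g′)) _ _ ⟩
      cycleCount M (contractAbove M (suc t) g) + cyclesAbove M (suc t) g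
    ∎
    where
    open ≡-Reasoning
    g′ = contract (M + t) g
    fixed = indicator (g (M + t) ≟ M + t)
    g-perm′ : IsPermBelow (suc (M + t)) g
    g-perm′ = subst (λ z → IsPermBelow z g) (+-suc M t) g-perm

  cycleCount≡cyclesAbove : ∀ N g → IsPermBelow N g → cycleCount N g ≡ cyclesAbove 0 N g
  cycleCount≡cyclesAbove = cycleCount-split 0

  contractAbove-below : ∀ M t g x → g x < M → contractAbove M t g x ≡ g x
  contractAbove-below M zero    g x _    = refl
  contractAbove-below M (suc t) g x gx<M =
    trans (contractAbove-below M t _ x (subst (_< M) (sym unchanged) gx<M)) unchanged
    where
    unchanged : contract (M + t) g x ≡ g x
    unchanged = contract-miss (M + t) g x
                  (λ gx≡M+t → <-irrefl refl (<-≤-trans (subst (_< M) gx≡M+t gx<M) (m≤m+n M t)))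

  contractAbove-shortcut : ∀ M t g x → M ≤ g x → g x < M + t → g (g x) < M →
                           contractAbove M t g x ≡ g (g x)
  contractAbove-shortcut M zero g x M≤gx gx<M+0 _ =
    ⊥-elim (<-irrefl refl (<-≤-trans gx<M+0 (≤-trans (≤-reflexive (+-identityʳ M)) M≤gx)))
  contractAbove-shortcut M (suc t) g x M≤gx gx<M+1+t g²x<M with g x ≟ M + t
  ... | yes gx≡M+t = trans (contractAbove-below M t _ x (subst (_< M) (sym shortcut) g²x<M)) shortcut
    where
    shortcut : contract (M + t) g x ≡ g (g x)
    shortcut = trans (contract-hit (M + t) g x gx≡M+t) (cong g (sym gx≡M+t))
  ... | no gx≢M+t = trans (contractAbove-shortcut M t g′ x M≤g′x g′x<M+t g′²x<M)
                          (trans (cong g′ unchanged) unchanged²)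
    where
    g′ = contract (M + t) g
    unchanged : g′ x ≡ g x
    unchanged = contract-miss (M + t) g x gx≢M+t
    unchanged² : g′ (g x) ≡ g (g x)
    unchanged² = contract-miss (M + t) g (g x)
                   (λ eq → <-irrefl refl (<-≤-trans (subst (_< M) eq g²x<M) (m≤m+n M t)))
    M≤g′x : M ≤ g′ x
    M≤g′x = subst (M ≤_) (sym unchanged) M≤gx
    g′x<M+t : g′ x < M + t
    g′x<M+t = subst (_< M + t) (sym unchanged)
                (≤∧≢⇒< (≤-pred (subst (g x <_) (+-suc M t) gx<M+1+t)) gx≢M+t)
    g′²x<M : g′ (g′ x) < M
    g′²x<M = subst (_< M) (sym (trans (cong g′ unchanged) unchanged²)) g²x<M

  cyclesAbove-escaping : ∀ M t g → (∀ y → M ≤ y → y < M + t → g y < M) → cyclesAbove M t g ≡ 0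
  cyclesAbove-escaping M zero    g _      = refl
  cyclesAbove-escaping M (suc t) g escape = cong₂ _+_ (cyclesAbove-escaping M t _ escape′) not-fixed
    where
    M+t<M+1+t : M + t < M + suc t
    M+t<M+1+t = subst (M + t <_) (sym (+-suc M t)) (n<1+n _)
    misses : ∀ y → M ≤ y → y < M + suc t → g y ≢ M + t
    misses y M≤y y< gy≡M+t = <-irrefl refl (<-≤-trans (subst (_< M) gy≡M+t (escape y M≤y y<)) (m≤m+n M t))
    escape′ : ∀ y → M ≤ y → y < M + t → contract (M + t) g y < M
    escape′ y M≤y y<M+t = subst (_< M) (sym (contract-miss (M + t) g y (misses y M≤y y<M+1+t)))
                                (escape y M≤y y<M+1+t)
      where y<M+1+t = <-trans y<M+t M+t<M+1+t
    not-fixed : indicator (g (M + t) ≟ M + t) ≡ 0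
    not-fixed with g (M + t) ≟ M + t
    ... | yes fixed = ⊥-elim (misses (M + t) (m≤m+n M t) M+t<M+1+t fixed)
    ... | no _      = refl

  cyclesAbove-shift : ∀ M t g h → IsPermBelow t h → (∀ y → y < t → g (M + y) ≡ M + h y) →
                      cyclesAbove M t g ≡ cyclesAbove 0 t h
  cyclesAbove-shift M zero    g h _      _       = refl
  cyclesAbove-shift M (suc t) g h h-perm shifted =
    cong₂ _+_ (cyclesAbove-shift M t _ _ (contract-isPermBelow h-perm) shifted′) same-fixed
    where
    same-fixed : indicator (g (M + t) ≟ M + t) ≡ indicator (h t ≟ t)
    same-fixed = indicator-cong _ _ (mk⇔
      (λ fixed → +-cancelˡ-≡ M _ _ (trans (sym (shifted t (n<1+n t))) fixed))
      (λ fixed → trans (shifted t (n<1+n t)) (cong (λ z → M + z) fixed)))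
    shifted′ : ∀ y → y < t → contract (M + t) g (M + y) ≡ M + contract t h y
    shifted′ y y<t = case-dec (h y ≟ t)
      (λ hit → trans (contract-hit (M + t) g (M + y) (trans (shifted y y<1+t) (cong (λ z → M + z) hit)))
                     (trans (shifted t (n<1+n t)) (cong (λ z → M + z) (sym (contract-hit t h y hit)))))
      (λ miss → trans (contract-miss (M + t) g (M + y)
                         (λ hit → miss (+-cancelˡ-≡ M _ _ (trans (sym (shifted y y<1+t)) hit))))
                      (trans (shifted y y<1+t) (cong (λ z → M + z) (sym (contract-miss t h y miss)))))
      where y<1+t = m≤n⇒m≤1+n y<t

module IntegerSums where

  open import Data.Nat using (zero; suc)
  open import Data.Integer using (ℤ; 0ℤ; _+_; _*_; +_)
  open import Data.Integer.Properties
  open import Data.Fin as Fin using (Fin; punchIn; punchOut)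
  import Data.Fin.Properties as Fin
  open import Data.List using (List; []; _∷_; map; concatMap; filter; _++_; tabulate; allFin; length)
  open import Data.Vec as Vec using (Vec; []; _∷_; _∷ʳ_; toList; replicate)
  open import Data.List.Relation.Unary.All using (All; []; _∷_)
  open import Data.List.Relation.Unary.Any using (here; there)
  open import Data.List.Membership.Propositional using (_∈_)
  open import Relation.Binary.PropositionalEquality
  open import Relation.Nullary using (Dec; yes; no; ¬_)
  open import Function using (_∘_; id; _⇔_; Equivalence)
  open ≡-Reasoning

  ∑ : ∀ {A : Set} → List A → (A → ℤ) → ℤ
  ∑ xs f = sumℤ (map f xs)

  ∑-++ : ∀ {A : Set} (xs ys : List A) f → ∑ (xs ++ ys) f ≡ ∑ xs f + ∑ ys f
  ∑-++ []       ys f = sym (+-identityˡ _)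
  ∑-++ (x ∷ xs) ys f = trans (cong (λ z → f x + z) (∑-++ xs ys f)) (sym (+-assoc (f x) _ _))

  ∑-cong : ∀ {A : Set} (xs : List A) {f g : A → ℤ} → (∀ x → f x ≡ g x) → ∑ xs f ≡ ∑ xs g
  ∑-cong []       _   = refl
  ∑-cong (x ∷ xs) f≗g = cong₂ _+_ (f≗g x) (∑-cong xs f≗g)

  ∑-cong-All : ∀ {A : Set} {xs : List A} {f g : A → ℤ} → All (λ x → f x ≡ g x) xs → ∑ xs f ≡ ∑ xs g
  ∑-cong-All []         = refl
  ∑-cong-All (eq ∷ eqs) = cong₂ _+_ eq (∑-cong-All eqs)

  ∑-map : ∀ {A B : Set} (xs : List A) (g : A → B) f → ∑ (map g xs) f ≡ ∑ xs (f ∘ g)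
  ∑-map []       g f = refl
  ∑-map (x ∷ xs) g f = cong (λ z → f (g x) + z) (∑-map xs g f)

  ∑-concatMap : ∀ {A B : Set} (xs : List A) (g : A → List B) f →
                ∑ (concatMap g xs) f ≡ ∑ xs (λ x → ∑ (g x) f)
  ∑-concatMap []       g f = refl
  ∑-concatMap (x ∷ xs) g f = trans (∑-++ (g x) (concatMap g xs) f) (cong (λ z → ∑ (g x) f + z) (∑-concatMap xs g f))

  ∑-zero : ∀ {A : Set} (xs : List A) → ∑ xs (λ _ → 0ℤ) ≡ 0ℤ
  ∑-zero []       = refl
  ∑-zero (x ∷ xs) = trans (+-identityˡ _) (∑-zero xs)

  ∑-*ˡ : ∀ {A : Set} (xs : List A) c f → ∑ xs (λ x → c * f x) ≡ c * ∑ xs f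
  ∑-*ˡ []       c f = sym (*-zeroʳ c)
  ∑-*ˡ (x ∷ xs) c f = trans (cong (λ z → c * f x + z) (∑-*ˡ xs c f)) (sym (*-distribˡ-+ c (f x) _))

  ∑-*ʳ : ∀ {A : Set} (xs : List A) f c → ∑ xs (λ x → f x * c) ≡ ∑ xs f * c
  ∑-*ʳ xs f c = trans (∑-cong xs (λ x → *-comm (f x) c)) (trans (∑-*ˡ xs c f) (*-comm c _))

  ∑-const : ∀ {A : Set} (xs : List A) c → ∑ xs (λ _ → c) ≡ + length xs * c
  ∑-const []       c = sym (*-zeroˡ c)
  ∑-const (x ∷ xs) c = begin
    c + ∑ xs (λ _ → c)     ≡⟨ cong (λ z → c + z) (∑-const xs c) ⟩
    c + + length xs * c    ≡⟨ cong (_+ + length xs * c) (sym (*-identityˡ c)) ⟩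
    + 1 * c + + length xs * c ≡⟨ sym (*-distribʳ-+ c (+ 1) (+ length xs)) ⟩
    + suc (length xs) * c  ∎

  guard : ∀ {P : Set} → Dec P → ℤ → ℤ
  guard (yes _) z = z
  guard (no _)  _ = 0ℤ

  guard-cong : ∀ {A B : Set} (a? : Dec A) (b? : Dec B) → A ⇔ B → ∀ z → guard a? z ≡ guard b? z
  guard-cong (yes _) (yes _) _   z = refl
  guard-cong (yes a) (no ¬b) a⇔b z with () ← ¬b (Equivalence.to a⇔b a)
  guard-cong (no ¬a) (yes b) a⇔b z with () ← ¬a (Equivalence.from a⇔b b)
  guard-cong (no _)  (no _)  _   z = refl

  guard-no : ∀ {A : Set} (a? : Dec A) → ¬ A → ∀ z → guard a? z ≡ 0ℤ
  guard-no (yes a) ¬a z with () ← ¬a a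
  guard-no (no _)  _  z = refl

  ∑-filter : ∀ {A : Set} {P : A → Set} (P? : ∀ x → Dec (P x)) (xs : List A) f →
             ∑ (filter P? xs) f ≡ ∑ xs (λ x → guard (P? x) (f x))
  ∑-filter P? []       f = refl
  ∑-filter P? (x ∷ xs) f with P? x
  ... | yes _ = cong (λ z → f x + z) (∑-filter P? xs f)
  ... | no _  = trans (∑-filter P? xs f) (sym (+-identityˡ _))

  ∑-vecsFrom-suc : ∀ {A : Set} (xs : List A) k (Ψ : Vec A (suc k) → ℤ) →
                   ∑ (vecsFrom xs (suc k)) Ψ ≡ ∑ (vecsFrom xs k) (λ v → ∑ xs (λ a → Ψ (a ∷ v)))
  ∑-vecsFrom-suc xs k Ψ = trans (∑-concatMap (vecsFrom xs k) _ Ψ)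
                                (∑-cong (vecsFrom xs k) (λ v → ∑-map xs (_∷ v) Ψ))

  ∑-vecsFrom-∷ʳ : ∀ {A : Set} (xs : List A) k (Ψ : Vec A (suc k) → ℤ) →
                  ∑ (vecsFrom xs (suc k)) Ψ ≡ ∑ xs (λ c → ∑ (vecsFrom xs k) (λ u → Ψ (u ∷ʳ c)))
  ∑-vecsFrom-∷ʳ xs zero Ψ =
    trans (∑-vecsFrom-suc xs zero Ψ) (trans (+-identityʳ _) (∑-cong xs (λ c → sym (+-identityʳ _))))
  ∑-vecsFrom-∷ʳ xs (suc k) Ψ = begin
    ∑ (vecsFrom xs (suc (suc k))) Ψ
      ≡⟨ ∑-vecsFrom-suc xs (suc k) Ψ ⟩
    ∑ (vecsFrom xs (suc k)) (λ v → ∑ xs (λ a → Ψ (a ∷ v)))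
      ≡⟨ ∑-vecsFrom-∷ʳ xs k _ ⟩
    ∑ xs (λ c → ∑ (vecsFrom xs k) (λ u → ∑ xs (λ a → Ψ (a ∷ (u ∷ʳ c)))))
      ≡⟨ ∑-cong xs (λ c → sym (∑-vecsFrom-suc xs k (λ w → Ψ (w ∷ʳ c)))) ⟩
    ∑ xs (λ c → ∑ (vecsFrom xs (suc k)) (λ u → Ψ (u ∷ʳ c))) ∎

  ∑-vecsFrom-cong : ∀ {A : Set} (xs ys : List A) → (∀ (θ : A → ℤ) → ∑ xs θ ≡ ∑ ys θ) →
                    ∀ k (Ψ : Vec A k → ℤ) → ∑ (vecsFrom xs k) Ψ ≡ ∑ (vecsFrom ys k) Ψ
  ∑-vecsFrom-cong xs ys same zero    Ψ = refl
  ∑-vecsFrom-cong xs ys same (suc k) Ψ = begin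
    ∑ (vecsFrom xs (suc k)) Ψ                              ≡⟨ ∑-vecsFrom-suc xs k Ψ ⟩
    ∑ (vecsFrom xs k) (λ v → ∑ xs (λ a → Ψ (a ∷ v)))      ≡⟨ ∑-cong (vecsFrom xs k) (λ v → same _) ⟩
    ∑ (vecsFrom xs k) (λ v → ∑ ys (λ a → Ψ (a ∷ v)))      ≡⟨ ∑-vecsFrom-cong xs ys same k _ ⟩
    ∑ (vecsFrom ys k) (λ v → ∑ ys (λ a → Ψ (a ∷ v)))      ≡⟨ sym (∑-vecsFrom-suc ys k Ψ) ⟩
    ∑ (vecsFrom ys (suc k)) Ψ                              ∎

  ∑-vecsFrom-map : ∀ {A B : Set} (xs : List A) (f : A → B) k (Ψ : Vec B k → ℤ) →
                   ∑ (vecsFrom (map f xs) k) Ψ ≡ ∑ (vecsFrom xs k) (Ψ ∘ Vec.map f)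
  ∑-vecsFrom-map xs f zero    Ψ = refl
  ∑-vecsFrom-map xs f (suc k) Ψ = begin
    ∑ (vecsFrom (map f xs) (suc k)) Ψ
      ≡⟨ ∑-vecsFrom-suc (map f xs) k Ψ ⟩
    ∑ (vecsFrom (map f xs) k) (λ v → ∑ (map f xs) (λ a → Ψ (a ∷ v)))
      ≡⟨ ∑-cong (vecsFrom (map f xs) k) (λ v → ∑-map xs f _) ⟩
    ∑ (vecsFrom (map f xs) k) (λ v → ∑ xs (λ a → Ψ (f a ∷ v)))
      ≡⟨ ∑-vecsFrom-map xs f k _ ⟩
    ∑ (vecsFrom xs k) (λ v → ∑ xs (λ a → Ψ (f a ∷ Vec.map f v)))
      ≡⟨ sym (∑-vecsFrom-suc xs k (Ψ ∘ Vec.map f)) ⟩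
    ∑ (vecsFrom xs (suc k)) (Ψ ∘ Vec.map f) ∎

  ∑-vecsFrom-drop : ∀ {A : Set} (c : A) (xs : List A) k (Ψ : Vec A k → ℤ) →
                    (∀ u → c ∈ toList u → Ψ u ≡ 0ℤ) →
                    ∑ (vecsFrom (c ∷ xs) k) Ψ ≡ ∑ (vecsFrom xs k) Ψ
  ∑-vecsFrom-drop c xs zero    Ψ _      = refl
  ∑-vecsFrom-drop c xs (suc k) Ψ vanish = begin
    ∑ (vecsFrom (c ∷ xs) (suc k)) Ψ
      ≡⟨ ∑-vecsFrom-suc (c ∷ xs) k Ψ ⟩
    ∑ (vecsFrom (c ∷ xs) k) (λ v → Ψ (c ∷ v) + ∑ xs (λ a → Ψ (a ∷ v)))
      ≡⟨ ∑-cong (vecsFrom (c ∷ xs) k) (λ v → trans (cong (_+ ∑ xs (λ a → Ψ (a ∷ v))) (vanish (c ∷ v) (here refl)))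
                                                   (+-identityˡ _)) ⟩
    ∑ (vecsFrom (c ∷ xs) k) (λ v → ∑ xs (λ a → Ψ (a ∷ v)))
      ≡⟨ ∑-vecsFrom-drop c xs k _ (λ u c∈u → trans (∑-cong xs (λ a → vanish (a ∷ u) (there c∈u))) (∑-zero xs)) ⟩
    ∑ (vecsFrom xs k) (λ v → ∑ xs (λ a → Ψ (a ∷ v)))
      ≡⟨ sym (∑-vecsFrom-suc xs k Ψ) ⟩
    ∑ (vecsFrom xs (suc k)) Ψ ∎

  ∑-vecsFrom-[_] : ∀ {A : Set} (a : A) k (Ψ : Vec A k → ℤ) → ∑ (vecsFrom (a ∷ []) k) Ψ ≡ Ψ (replicate k a)
  ∑-vecsFrom-[ a ] zero    Ψ = +-identityʳ _
  ∑-vecsFrom-[ a ] (suc k) Ψ = trans (∑-vecsFrom-suc (a ∷ []) k Ψ) (trans (∑-vecsFrom-[ a ] k _) (+-identityʳ _))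

  SumInvariant : ∀ {A : Set} → List A → (A → A) → Set
  SumInvariant xs φ = ∀ (θ : _ → ℤ) → ∑ xs (θ ∘ φ) ≡ ∑ xs θ

  zipApply : ∀ {A : Set} {k} → Vec (A → A) k → Vec A k → Vec A k
  zipApply []       []      = []
  zipApply (φ ∷ φs) (a ∷ v) = φ a ∷ zipApply φs v

  ∑-vecsFrom-zipApply : ∀ {A : Set} (xs : List A) k (φs : Vec (A → A) k) →
                        (∀ i → SumInvariant xs (Vec.lookup φs i)) →
                        SumInvariant (vecsFrom xs k) (zipApply φs)
  ∑-vecsFrom-zipApply xs zero    []       _         Ψ = refl
  ∑-vecsFrom-zipApply xs (suc k) (φ ∷ φs) invariant Ψ = begin
    ∑ (vecsFrom xs (suc k)) (Ψ ∘ zipApply (φ ∷ φs))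
      ≡⟨ ∑-vecsFrom-suc xs k _ ⟩
    ∑ (vecsFrom xs k) (λ v → ∑ xs (λ a → Ψ (φ a ∷ zipApply φs v)))
      ≡⟨ ∑-cong (vecsFrom xs k) (λ v → invariant Fin.zero (λ a → Ψ (a ∷ zipApply φs v))) ⟩
    ∑ (vecsFrom xs k) (λ v → ∑ xs (λ a → Ψ (a ∷ zipApply φs v)))
      ≡⟨ ∑-vecsFrom-zipApply xs k φs (invariant ∘ Fin.suc) (λ v → ∑ xs (λ a → Ψ (a ∷ v))) ⟩
    ∑ (vecsFrom xs k) (λ v → ∑ xs (λ a → Ψ (a ∷ v)))
      ≡⟨ sym (∑-vecsFrom-suc xs k Ψ) ⟩
    ∑ (vecsFrom xs (suc k)) Ψ ∎

  ∑ᶠ : ∀ {n} → (Fin n → ℤ) → ℤ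
  ∑ᶠ {zero}  h = 0ℤ
  ∑ᶠ {suc n} h = h Fin.zero + ∑ᶠ (h ∘ Fin.suc)

  ∑ᶠ-cong : ∀ {n} {f g : Fin n → ℤ} → (∀ i → f i ≡ g i) → ∑ᶠ f ≡ ∑ᶠ g
  ∑ᶠ-cong {zero}  _   = refl
  ∑ᶠ-cong {suc n} f≗g = cong₂ _+_ (f≗g Fin.zero) (∑ᶠ-cong (f≗g ∘ Fin.suc))

  ∑-tabulate : ∀ {A : Set} {n} (g : Fin n → A) (θ : A → ℤ) → ∑ (tabulate g) θ ≡ ∑ᶠ (θ ∘ g)
  ∑-tabulate {n = zero}  g θ = refl
  ∑-tabulate {n = suc n} g θ = cong (λ z → θ (g Fin.zero) + z) (∑-tabulate (g ∘ Fin.suc) θ)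

  ∑-allFin : ∀ n (θ : Fin n → ℤ) → ∑ (allFin n) θ ≡ ∑ᶠ θ
  ∑-allFin n = ∑-tabulate id

  ∑ᶠ-punchIn : ∀ {m} (c : Fin (suc m)) (h : Fin (suc m) → ℤ) → ∑ᶠ h ≡ h c + ∑ᶠ (h ∘ punchIn c)
  ∑ᶠ-punchIn Fin.zero h = refl
  ∑ᶠ-punchIn {suc m} (Fin.suc c) h = begin
    h₀ + ∑ᶠ (h ∘ Fin.suc)                          ≡⟨ cong (λ z → h₀ + z) (∑ᶠ-punchIn c (h ∘ Fin.suc)) ⟩
    h₀ + (h (Fin.suc c) + rest)                     ≡⟨ sym (+-assoc h₀ _ _) ⟩
    (h₀ + h (Fin.suc c)) + rest                     ≡⟨ cong (_+ rest) (+-comm h₀ _) ⟩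
    (h (Fin.suc c) + h₀) + rest                     ≡⟨ +-assoc (h (Fin.suc c)) _ _ ⟩
    h (Fin.suc c) + ∑ᶠ (h ∘ punchIn (Fin.suc c))   ∎
    where
    h₀ = h Fin.zero
    rest = ∑ᶠ (h ∘ Fin.suc ∘ punchIn c)

  ∑ᶠ-injective : ∀ {n} (π : Fin n → Fin n) → (∀ {i j} → π i ≡ π j → i ≡ j) →
                 ∀ (h : Fin n → ℤ) → ∑ᶠ (h ∘ π) ≡ ∑ᶠ h
  ∑ᶠ-injective {zero}  π π-inj h = refl
  ∑ᶠ-injective {suc n} π π-inj h = begin
    h c + ∑ᶠ (h ∘ π ∘ Fin.suc)         ≡⟨ cong (λ z → h c + z) (∑ᶠ-cong (λ i → cong h (sym (Fin.punchIn-punchOut (c≢ i))))) ⟩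
    h c + ∑ᶠ (h ∘ punchIn c ∘ ρ)       ≡⟨ cong (λ z → h c + z) (∑ᶠ-injective ρ ρ-inj (h ∘ punchIn c)) ⟩
    h c + ∑ᶠ (h ∘ punchIn c)           ≡⟨ sym (∑ᶠ-punchIn c h) ⟩
    ∑ᶠ h                                ∎
    where
    c = π Fin.zero
    c≢ : ∀ i → c ≢ π (Fin.suc i)
    c≢ i eq with () ← π-inj eq
    ρ : Fin n → Fin n
    ρ i = punchOut (c≢ i)
    ρ-inj : ∀ {i j} → ρ i ≡ ρ j → i ≡ j
    ρ-inj {i} {j} eq = Fin.suc-injective (π-inj (Fin.punchOut-injective (c≢ i) (c≢ j) eq))

  ∑ᶠ-split : ∀ {m} (c : Fin (suc m)) (f : Fin m → Fin (suc m)) → (∀ {i j} → f i ≡ f j → i ≡ j) →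
             (∀ i → c ≢ f i) → ∀ (h : Fin (suc m) → ℤ) → ∑ᶠ h ≡ h c + ∑ᶠ (h ∘ f)
  ∑ᶠ-split c f f-inj c≢ h = begin
    ∑ᶠ h                          ≡⟨ ∑ᶠ-punchIn c h ⟩
    h c + ∑ᶠ (h ∘ punchIn c)      ≡⟨ cong (λ z → h c + z) (sym (∑ᶠ-injective ρ ρ-inj (h ∘ punchIn c))) ⟩
    h c + ∑ᶠ (h ∘ punchIn c ∘ ρ)  ≡⟨ cong (λ z → h c + z) (∑ᶠ-cong (λ i → cong h (Fin.punchIn-punchOut (c≢ i)))) ⟩
    h c + ∑ᶠ (h ∘ f)              ∎
    where
    ρ : Fin _ → Fin _
    ρ i = punchOut (c≢ i)
    ρ-inj : ∀ {i j} → ρ i ≡ ρ j → i ≡ j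
    ρ-inj {i} {j} eq = f-inj (Fin.punchOut-injective (c≢ i) (c≢ j) eq)

module SymmetricGroup where

  open import Data.Nat using (zero; suc)
  open import Data.Integer using (ℤ; _+_)
  open import Data.Fin as Fin using (Fin; fromℕ; inject₁)
  open import Data.Fin.Properties as Fin using (_≟_)
  open import Data.List using ([]; _∷_; map; allFin)
  open import Data.Vec as Vec using (Vec; []; _∷_; _∷ʳ_; toList; lookup)
  open import Data.List.Relation.Unary.All as All using (All; []; _∷_)
  open import Data.List.Relation.Unary.AllPairs using (AllPairs; []; _∷_)
  open import Data.List.Relation.Unary.Any using (here; there)
  open import Data.List.Membership.Propositional using (_∈_)
  import Data.List.Relation.Unary.Unique.DecPropositional as UniqueDec
  open import Relation.Binary.PropositionalEquality
  open import Relation.Nullary using (Dec; yes; no; ¬_)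
  open import Data.Empty using (⊥-elim)
  open import Function using (_∘_; _⇔_; mk⇔; Equivalence)
  open import Function.Properties.Equivalence using () renaming (sym to ⇔-sym)
  open IntegerSums

  Distinct : ∀ {n k} → Vec (Fin n) k → Set
  Distinct v = AllPairs (λ x y → ¬ x ≡ y) (toList v)

  distinct? : ∀ {n k} (v : Vec (Fin n) k) → Dec (Distinct v)
  distinct? v = UniqueDec.unique? _≟_ (toList v)

  All-toList⇒lookup : ∀ {A : Set} {P : A → Set} {k} (v : Vec A k) → All P (toList v) → ∀ i → P (lookup v i)
  All-toList⇒lookup (x ∷ v) (px ∷ _)   Fin.zero    = px
  All-toList⇒lookup (x ∷ v) (_  ∷ pxs) (Fin.suc i) = All-toList⇒lookup v pxs i

  distinct⇒lookup-injective : ∀ {n k} (v : Vec (Fin n) k) → Distinct v →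
                              ∀ {i j} → lookup v i ≡ lookup v j → i ≡ j
  distinct⇒lookup-injective (x ∷ v) (x∉ ∷ _) {Fin.zero}  {Fin.zero}  _  = refl
  distinct⇒lookup-injective (x ∷ v) (x∉ ∷ _) {Fin.zero}  {Fin.suc j} eq = ⊥-elim (All-toList⇒lookup v x∉ j eq)
  distinct⇒lookup-injective (x ∷ v) (x∉ ∷ _) {Fin.suc i} {Fin.zero}  eq = ⊥-elim (All-toList⇒lookup v x∉ i (sym eq))
  distinct⇒lookup-injective (x ∷ v) (_ ∷ dv) {Fin.suc i} {Fin.suc j} eq = cong Fin.suc (distinct⇒lookup-injective v dv eq)

  ∈-∷ʳ : ∀ {A : Set} {k} (c : A) (u : Vec A k) → c ∈ toList (u ∷ʳ c)
  ∈-∷ʳ c []      = here refl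
  ∈-∷ʳ c (x ∷ u) = there (∈-∷ʳ c u)

  ∈⇒¬distinct-∷ʳ : ∀ {n k} (c : Fin n) (u : Vec (Fin n) k) → c ∈ toList u → ¬ Distinct (u ∷ʳ c)
  ∈⇒¬distinct-∷ʳ c (x ∷ u) (here c≡x)  (x∉ ∷ _)  = All.lookup x∉ (∈-∷ʳ c u) (sym c≡x)
  ∈⇒¬distinct-∷ʳ c (x ∷ u) (there c∈u) (_ ∷ du) = ∈⇒¬distinct-∷ʳ c u c∈u du

  module _ {n m} (f : Fin m → Fin n) (f-inj : ∀ {i j} → f i ≡ f j → i ≡ j) where

    private
      ∉-map⇔ : ∀ {k} x (u : Vec (Fin m) k) →
               All (λ y → ¬ f x ≡ y) (toList (Vec.map f u)) ⇔ All (λ y → ¬ x ≡ y) (toList u)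
      ∉-map⇔ x []      = mk⇔ (λ _ → []) (λ _ → [])
      ∉-map⇔ x (y ∷ u) = mk⇔ (λ { (fx≢ ∷ r) → (fx≢ ∘ cong f) ∷ Equivalence.to (∉-map⇔ x u) r })
                             (λ { (x≢ ∷ r) → (x≢ ∘ f-inj) ∷ Equivalence.from (∉-map⇔ x u) r })

    distinct-map⇔ : ∀ {k} (u : Vec (Fin m) k) → Distinct (Vec.map f u) ⇔ Distinct u
    distinct-map⇔ []      = mk⇔ (λ _ → []) (λ _ → [])
    distinct-map⇔ (x ∷ u) = mk⇔ (λ { (a ∷ d) → Equivalence.to (∉-map⇔ x u) a ∷ Equivalence.to (distinct-map⇔ u) d })
                                (λ { (a ∷ d) → Equivalence.from (∉-map⇔ x u) a ∷ Equivalence.from (distinct-map⇔ u) d })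

    module _ (c : Fin n) (f≢c : ∀ j → ¬ f j ≡ c) where

      private
        ∉-map-∷ʳ⇔ : ∀ {k} x (u : Vec (Fin m) k) →
                    All (λ y → ¬ f x ≡ y) (toList (Vec.map f u ∷ʳ c)) ⇔ All (λ y → ¬ x ≡ y) (toList u)
        ∉-map-∷ʳ⇔ x []      = mk⇔ (λ _ → []) (λ _ → f≢c x ∷ [])
        ∉-map-∷ʳ⇔ x (y ∷ u) = mk⇔ (λ { (fx≢ ∷ r) → (fx≢ ∘ cong f) ∷ Equivalence.to (∉-map-∷ʳ⇔ x u) r })
                                  (λ { (x≢ ∷ r) → (x≢ ∘ f-inj) ∷ Equivalence.from (∉-map-∷ʳ⇔ x u) r })

      distinct-map-∷ʳ⇔ : ∀ {k} (u : Vec (Fin m) k) → Distinct (Vec.map f u ∷ʳ c) ⇔ Distinct u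
      distinct-map-∷ʳ⇔ []      = mk⇔ (λ _ → []) (λ _ → [] ∷ [])
      distinct-map-∷ʳ⇔ (x ∷ u) =
        mk⇔ (λ { (a ∷ d) → Equivalence.to (∉-map-∷ʳ⇔ x u) a ∷ Equivalence.to (distinct-map-∷ʳ⇔ u) d })
            (λ { (a ∷ d) → Equivalence.from (∉-map-∷ʳ⇔ x u) a ∷ Equivalence.from (distinct-map-∷ʳ⇔ u) d })

  reroute : ∀ {m} → Fin (suc m) → Fin m → Fin (suc m)
  reroute {m} c j with inject₁ j ≟ c
  ... | yes _ = fromℕ m
  ... | no _  = inject₁ j

  reroute-hit : ∀ {m} (c : Fin (suc m)) j → inject₁ j ≡ c → reroute c j ≡ fromℕ m
  reroute-hit c j j≡c with inject₁ j ≟ c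
  ... | yes _   = refl
  ... | no j≢c = ⊥-elim (j≢c j≡c)

  reroute-miss : ∀ {m} (c : Fin (suc m)) j → ¬ inject₁ j ≡ c → reroute c j ≡ inject₁ j
  reroute-miss c j j≢c with inject₁ j ≟ c
  ... | yes j≡c = ⊥-elim (j≢c j≡c)
  ... | no _    = refl

  reroute≢ : ∀ {m} (c : Fin (suc m)) j → ¬ reroute c j ≡ c
  reroute≢ c j eq with inject₁ j ≟ c
  ... | yes j≡c = Fin.fromℕ≢inject₁ (trans eq (sym j≡c))
  ... | no j≢c  = j≢c eq

  reroute-injective : ∀ {m} (c : Fin (suc m)) {i j} → reroute c i ≡ reroute c j → i ≡ j
  reroute-injective c {i} {j} eq with inject₁ i ≟ c | inject₁ j ≟ c
  ... | yes i≡c | yes j≡c = Fin.inject₁-injective (trans i≡c (sym j≡c))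
  ... | yes _   | no _    = ⊥-elim (Fin.fromℕ≢inject₁ eq)
  ... | no _    | yes _   = ⊥-elim (Fin.fromℕ≢inject₁ (sym eq))
  ... | no _    | no _    = Fin.inject₁-injective eq

  ∑-allFin-reroute : ∀ {m} (c : Fin (suc m)) (θ : Fin (suc m) → ℤ) →
                     ∑ (allFin (suc m)) θ ≡ ∑ (c ∷ map (reroute c) (allFin m)) θ
  ∑-allFin-reroute {m} c θ = begin
    ∑ (allFin (suc m)) θ                   ≡⟨ ∑-allFin (suc m) θ ⟩
    ∑ᶠ θ                                   ≡⟨ ∑ᶠ-split c (reroute c) (reroute-injective c) (λ i → reroute≢ c i ∘ sym) θ ⟩
    θ c + ∑ᶠ (θ ∘ reroute c)               ≡⟨ cong (λ z → θ c + z) (sym (∑-allFin m (θ ∘ reroute c))) ⟩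
    θ c + ∑ (allFin m) (θ ∘ reroute c)     ≡⟨ cong (λ z → θ c + z) (sym (∑-map (allFin m) (reroute c) θ)) ⟩
    ∑ (c ∷ map (reroute c) (allFin m)) θ   ∎
    where
    open ≡-Reasoning

  -- The permutation of {0,…,m} sending m to c and σ⁻¹(c) to m, and agreeing with σ elsewhere.
  extend : ∀ {m} → Fin (suc m) → Perm m → Perm (suc m)
  extend c σ = Vec.map (reroute c) σ ∷ʳ c

  ∑-symGroup-suc : ∀ m (Φ : Perm (suc m) → ℤ) →
                   ∑ (symGroup (suc m)) Φ ≡ ∑ (allFin (suc m)) (λ c → ∑ (symGroup m) (Φ ∘ extend c))
  ∑-symGroup-suc m Φ = begin
    ∑ (symGroup (suc m)) Φ
      ≡⟨ ∑-filter distinct? (vecsFrom points′ (suc m)) Φ ⟩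
    ∑ (vecsFrom points′ (suc m)) (λ v → guard (distinct? v) (Φ v))
      ≡⟨ ∑-vecsFrom-∷ʳ points′ m _ ⟩
    ∑ points′ (λ c → ∑ (vecsFrom points′ m) (Ψ c))
      ≡⟨ ∑-cong points′ last-entry ⟩
    ∑ points′ (λ c → ∑ (symGroup m) (Φ ∘ extend c)) ∎
    where
    open ≡-Reasoning
    points′ = allFin (suc m)
    points  = allFin m
    Ψ : Fin (suc m) → Vec (Fin (suc m)) m → ℤ
    Ψ c u = guard (distinct? (u ∷ʳ c)) (Φ (u ∷ʳ c))
    last-entry : ∀ c → ∑ (vecsFrom points′ m) (Ψ c) ≡ ∑ (symGroup m) (Φ ∘ extend c)
    last-entry c = begin
      ∑ (vecsFrom points′ m) (Ψ c)
        ≡⟨ ∑-vecsFrom-cong points′ _ (∑-allFin-reroute c) m (Ψ c) ⟩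
      ∑ (vecsFrom (c ∷ map (reroute c) points) m) (Ψ c)
        ≡⟨ ∑-vecsFrom-drop c _ m (Ψ c) (λ u c∈u → guard-no (distinct? (u ∷ʳ c)) (∈⇒¬distinct-∷ʳ c u c∈u) _) ⟩
      ∑ (vecsFrom (map (reroute c) points) m) (Ψ c)
        ≡⟨ ∑-vecsFrom-map points (reroute c) m (Ψ c) ⟩
      ∑ (vecsFrom points m) (Ψ c ∘ Vec.map (reroute c))
        ≡⟨ ∑-cong (vecsFrom points m) (λ u → guard-cong (distinct? (extend c u)) (distinct? u)
             (distinct-map-∷ʳ⇔ (reroute c) (reroute-injective c) c (reroute≢ c) u) _) ⟩
      ∑ (vecsFrom points m) (λ u → guard (distinct? u) (Φ (extend c u)))
        ≡⟨ sym (∑-filter distinct? (vecsFrom points m) (Φ ∘ extend c)) ⟩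
      ∑ (symGroup m) (Φ ∘ extend c) ∎

  compose : ∀ {n} → Perm n → Perm n → Perm n
  compose h v = Vec.map (lookup h) v

  ∑-symGroup-compose : ∀ n (h : Perm n) → Distinct h → SumInvariant (symGroup n) (compose h)
  ∑-symGroup-compose n h dh θ = begin
    ∑ (symGroup n) (θ ∘ compose h)
      ≡⟨ ∑-filter distinct? (vecsFrom points n) (θ ∘ compose h) ⟩
    ∑ (vecsFrom points n) (λ v → guard (distinct? v) (θ (compose h v)))
      ≡⟨ ∑-cong (vecsFrom points n) (λ v → guard-cong (distinct? v) (distinct? (compose h v))
           (⇔-sym (distinct-map⇔ (lookup h) h-inj v)) _) ⟩
    ∑ (vecsFrom points n) (Ψ ∘ Vec.map (lookup h))
      ≡⟨ sym (∑-vecsFrom-map points (lookup h) n Ψ) ⟩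
    ∑ (vecsFrom (map (lookup h) points) n) Ψ
      ≡⟨ ∑-vecsFrom-cong _ _ permuted n Ψ ⟩
    ∑ (vecsFrom points n) Ψ
      ≡⟨ sym (∑-filter distinct? (vecsFrom points n) θ) ⟩
    ∑ (symGroup n) θ ∎
    where
    open ≡-Reasoning
    points = allFin n
    h-inj = distinct⇒lookup-injective h dh
    Ψ = λ v → guard (distinct? v) (θ v)
    permuted : ∀ (ϑ : Fin n → ℤ) → ∑ (map (lookup h) points) ϑ ≡ ∑ points ϑ
    permuted ϑ = trans (∑-map points (lookup h) ϑ)
                   (trans (∑-allFin n _) (trans (∑ᶠ-injective (lookup h) h-inj ϑ) (sym (∑-allFin n ϑ))))

-- The point (i , j) of the wreath action is coded by key (i , j) = i·n + j; actℕ g is then a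
-- permutation of {0,…,mn-1} whose cycle count is `cycles g`.
module Encoding where

  open import Data.Nat
  open import Data.Nat.Properties
  open import Data.Fin as Fin using (Fin; fromℕ<; toℕ; combine; remQuot)
  import Data.Fin.Properties as Fin
  open import Data.List using (List; []; _∷_; map; filter; _++_; tabulate; allFin; length; upTo; applyUpTo; cartesianProduct)
  open import Data.List.Properties using (map-++; map-tabulate; tabulate-cong)
  open import Data.Vec using (Vec; lookup)
  open import Data.List.Relation.Unary.All as All using (All)
  open import Relation.Binary.PropositionalEquality hiding ([_])
  open import Relation.Nullary using (Dec; yes; no)
  open import Data.Empty using (⊥-elim)
  open import Data.Product using (_×_; _,_; proj₁; proj₂)
  open import Function using (_∘_; id; _⇔_; mk⇔)
  open CycleCount

  actℕ : ∀ {n m} → Wreath n m → ℕ → ℕ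
  actℕ {n} {m} g x with x <? m * n
  ... | yes x<mn = key (act g (remQuot {m} n (fromℕ< x<mn)))
  ... | no _     = x

  module _ {n m : ℕ} where

    actℕ-< : ∀ (g : Wreath n m) x (x<mn : x < m * n) → actℕ g x ≡ key (act g (remQuot {m} n (fromℕ< x<mn)))
    actℕ-< g x x<mn with x <? m * n
    ... | yes _    = refl
    ... | no x≮mn = ⊥-elim (x≮mn x<mn)

    key≡toℕ-combine : ∀ (p : Fin m × Fin n) → key p ≡ toℕ (combine (proj₁ p) (proj₂ p))
    key≡toℕ-combine (i , j) = trans (cong (_+ toℕ j) (*-comm (toℕ i) n)) (sym (Fin.toℕ-combine i j))

    key< : ∀ (p : Fin m × Fin n) → key p < m * n
    key< p = subst (_< m * n) (sym (key≡toℕ-combine p)) (Fin.toℕ<n _)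

    key-injective : ∀ {p q : Fin m × Fin n} → key p ≡ key q → p ≡ q
    key-injective {i , j} {k , l} eq = begin
      (i , j)                                ≡⟨ sym (Fin.remQuot-combine i j) ⟩
      remQuot n (combine i j)                ≡⟨ cong (remQuot n) (Fin.toℕ-injective same-combine) ⟩
      remQuot n (combine k l)                ≡⟨ Fin.remQuot-combine k l ⟩
      (k , l)                                ∎
      where
      open ≡-Reasoning
      same-combine = trans (sym (key≡toℕ-combine (i , j))) (trans eq (key≡toℕ-combine (k , l)))

    decode : ∀ {x} → x < m * n → Fin m × Fin n
    decode x<mn = remQuot {m} n (fromℕ< x<mn)

    key-decode : ∀ x (x<mn : x < m * n) → key (decode x<mn) ≡ x
    key-decode x x<mn = trans (key≡toℕ-combine (decode x<mn))
                              (trans (cong toℕ (Fin.combine-remQuot {m} n (fromℕ< x<mn))) (Fin.toℕ-fromℕ< x<mn))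

    actℕ-key : ∀ (g : Wreath n m) p → actℕ g (key p) ≡ key (act g p)
    actℕ-key g p = trans (actℕ-< g (key p) (key< p))
                         (cong (key ∘ act g) (key-injective (key-decode (key p) (key< p))))

    actℕ-decode : ∀ (g : Wreath n m) {x} (x<mn : x < m * n) → actℕ g x ≡ key (act g (decode x<mn))
    actℕ-decode g {x} x<mn = trans (cong (actℕ g) (sym (key-decode x x<mn))) (actℕ-key g (decode x<mn))

    iter-actℕ-key : ∀ (g : Wreath n m) k p → iter (actℕ g) k (key p) ≡ key (iter (act g) k p)
    iter-actℕ-key g zero    p = refl
    iter-actℕ-key g (suc k) p = trans (cong (actℕ g) (iter-actℕ-key g k p)) (actℕ-key g _)

  length-filter-map : ∀ {A B : Set} {Q : B → Set} (f : A → B) (Q? : ∀ b → Dec (Q b)) (xs : List A) →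
                      length (filter (Q? ∘ f) xs) ≡ length (filter Q? (map f xs))
  length-filter-map f Q? []       = refl
  length-filter-map f Q? (x ∷ xs) with Q? (f x)
  ... | yes _ = cong suc (length-filter-map f Q? xs)
  ... | no _  = length-filter-map f Q? xs

  applyUpTo-cong : ∀ {A : Set} {f g : ℕ → A} → (∀ x → f x ≡ g x) → ∀ k → applyUpTo f k ≡ applyUpTo g k
  applyUpTo-cong f≗g zero    = refl
  applyUpTo-cong f≗g (suc k) = cong₂ _∷_ (f≗g 0) (applyUpTo-cong (f≗g ∘ suc) k)

  applyUpTo-+ : ∀ {A : Set} (f : ℕ → A) a b → applyUpTo f (a + b) ≡ applyUpTo f a ++ applyUpTo (λ x → f (a + x)) b
  applyUpTo-+ f zero    b = refl
  applyUpTo-+ f (suc a) b = cong (f 0 ∷_) (applyUpTo-+ (f ∘ suc) a b)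

  tabulate-toℕ : ∀ {A : Set} k (f : ℕ → A) → tabulate {n = k} (f ∘ toℕ) ≡ applyUpTo f k
  tabulate-toℕ zero    f = refl
  tabulate-toℕ (suc k) f = cong (f 0 ∷_) (tabulate-toℕ k (f ∘ suc))

  module _ {n m : ℕ} where

    map-key-rows : ∀ m′ (row : Fin m′ → Fin m) off → (∀ i → toℕ (row i) ≡ off + toℕ i) →
                   map (key {n} {m}) (cartesianProduct (tabulate row) (allFin n)) ≡ applyUpTo (λ x → off * n + x) (m′ * n)
    map-key-rows zero     row off _      = refl
    map-key-rows (suc m′) row off row≡ = begin
        map key (map (row Fin.zero ,_) (allFin n) ++ cartesianProduct (tabulate (row ∘ Fin.suc)) (allFin n))
      ≡⟨ map-++ key (map (row Fin.zero ,_) (allFin n)) _ ⟩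
        map key (map (row Fin.zero ,_) (allFin n)) ++ map key (cartesianProduct (tabulate (row ∘ Fin.suc)) (allFin n))
      ≡⟨ cong₂ _++_ first-row (map-key-rows m′ (row ∘ Fin.suc) (suc off) (λ i → trans (row≡ (Fin.suc i)) (+-suc off (toℕ i)))) ⟩
        applyUpTo (λ x → off * n + x) n ++ applyUpTo (λ x → suc off * n + x) (m′ * n)
      ≡⟨ cong (applyUpTo (λ x → off * n + x) n ++_)
              (applyUpTo-cong (λ x → trans (cong (_+ x) (+-comm n (off * n))) (+-assoc (off * n) n x)) (m′ * n)) ⟩
        applyUpTo (λ x → off * n + x) n ++ applyUpTo (λ x → off * n + (n + x)) (m′ * n)
      ≡⟨ sym (applyUpTo-+ (λ x → off * n + x) n (m′ * n)) ⟩
        applyUpTo (λ x → off * n + x) (suc m′ * n)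
      ∎
      where
      open ≡-Reasoning
      first-row : map key (map (row Fin.zero ,_) (allFin n)) ≡ applyUpTo (λ x → off * n + x) n
      first-row = begin
          map key (map (row Fin.zero ,_) (tabulate id))
        ≡⟨ cong (map key) (map-tabulate id (row Fin.zero ,_)) ⟩
          map key (tabulate (row Fin.zero ,_))
        ≡⟨ map-tabulate (row Fin.zero ,_) key ⟩
          tabulate (λ j → toℕ (row Fin.zero) * n + toℕ j)
        ≡⟨ tabulate-cong (λ j → cong (λ z → z * n + toℕ j) (trans (row≡ Fin.zero) (+-identityʳ off))) ⟩
          tabulate ((λ x → off * n + x) ∘ toℕ)
        ≡⟨ tabulate-toℕ n (λ x → off * n + x) ⟩
          applyUpTo (λ x → off * n + x) n
        ∎

    map-key-points : map (key {n} {m}) (cartesianProduct (allFin m) (allFin n)) ≡ upTo (m * n)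
    map-key-points = trans (map-key-rows m id 0 (λ _ → refl)) (applyUpTo-cong (λ _ → refl) (m * n))

    cycles≡cycleCount : ∀ (g : Wreath n m) → cycles g ≡ cycleCount (m * n) (actℕ g)
    cycles≡cycleCount g = begin
        cycles g
      ≡⟨ length-filter-cong _ _ points (All.tabulate (λ {p} _ → same-leaders p)) ⟩
        length (filter (isLeader? (m * n) (actℕ g) ∘ key) points)
      ≡⟨ length-filter-map key (isLeader? (m * n) (actℕ g)) points ⟩
        length (filter (isLeader? (m * n) (actℕ g)) (map key points))
      ≡⟨ cong (length ∘ filter (isLeader? (m * n) (actℕ g))) map-key-points ⟩
        cycleCount (m * n) (actℕ g)
      ∎
      where
      open ≡-Reasoning
      points = cartesianProduct (allFin m) (allFin n)
      same-leaders : ∀ p → isLeader g p ⇔ IsLeader (m * n) (actℕ g) (key p)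
      same-leaders p = mk⇔ (All.map (λ {k} → subst (key p ≤_) (sym (iter-actℕ-key g k p))))
                           (All.map (λ {k} → subst (key p ≤_) (iter-actℕ-key g k p)))

  LookupInjective : ∀ {A : Set} {k} → Vec A k → Set
  LookupInjective {k = k} v = ∀ {i j : Fin k} → lookup v i ≡ lookup v j → i ≡ j

  WellFormed : ∀ {n m} → Wreath n m → Set
  WellFormed (σ , f) = LookupInjective σ × (∀ a → LookupInjective (lookup f a))

  module _ {n m : ℕ} where

    act-injective : ∀ (g : Wreath n m) → WellFormed g → ∀ {p q} → act g p ≡ act g q → p ≡ q
    act-injective (σ , f) (σ-inj , f-inj) {i , j} {k , l} eq with σ-inj (cong proj₁ eq)
    ... | refl = cong (i ,_) (f-inj i (cong proj₂ eq))

    actℕ-isPermBelow : ∀ (g : Wreath n m) → WellFormed g → IsPermBelow (m * n) (actℕ g)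
    actℕ-isPermBelow g g-wf = bounded , injective
      where
      bounded : ∀ {x} → x < m * n → actℕ g x < m * n
      bounded x<mn = subst (_< m * n) (sym (actℕ-decode g x<mn)) (key< {n} {m} (act g (decode x<mn)))
      injective : ∀ {x y} → x < m * n → y < m * n → actℕ g x ≡ actℕ g y → x ≡ y
      injective {x} {y} x<mn y<mn eq = begin
        x                          ≡⟨ sym (key-decode {n} {m} x x<mn) ⟩
        key (decode {n} {m} x<mn)  ≡⟨ cong key (act-injective g g-wf (key-injective {n} {m} same-image)) ⟩
        key (decode {n} {m} y<mn)  ≡⟨ key-decode {n} {m} y y<mn ⟩
        y                          ∎
        where
        open ≡-Reasoning
        same-image = trans (sym (actℕ-decode g x<mn)) (trans eq (actℕ-decode g y<mn))

module TopCopy where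

  open import Data.Nat
  open import Data.Nat.Properties
  open import Data.Fin as Fin using (Fin; fromℕ; fromℕ<; inject₁; toℕ)
  open import Data.Fin.Properties as Fin using () renaming (_≟_ to _≟ᶠ_)
  open import Data.Vec as Vec using (Vec; []; _∷_; _∷ʳ_; lookup)
  import Data.Vec.Properties as Vec
  open import Relation.Binary.PropositionalEquality
  open import Relation.Nullary using (yes; no; ¬_)
  open import Data.Empty using (⊥-elim)
  open import Data.Product using (_,_; proj₁; proj₂)
  open import Function using (id)
  open CycleCount
  open IntegerSums using (zipApply)
  open SymmetricGroup using (reroute; reroute-hit; reroute-miss; extend; compose)
  open Encoding

  lookup-∷ʳ-inject₁ : ∀ {A : Set} {k} (u : Vec A k) x a → lookup (u ∷ʳ x) (inject₁ a) ≡ lookup u a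
  lookup-∷ʳ-inject₁ (y ∷ u) x Fin.zero    = refl
  lookup-∷ʳ-inject₁ (y ∷ u) x (Fin.suc a) = lookup-∷ʳ-inject₁ u x a

  lookup-∷ʳ-fromℕ : ∀ {A : Set} {k} (u : Vec A k) x → lookup (u ∷ʳ x) (fromℕ k) ≡ x
  lookup-∷ʳ-fromℕ []      x = refl
  lookup-∷ʳ-fromℕ (y ∷ u) x = lookup-∷ʳ-fromℕ u x

  lookup-zipApply : ∀ {A : Set} {k} (φs : Vec (A → A) k) (u : Vec A k) a →
                    lookup (zipApply φs u) a ≡ lookup φs a (lookup u a)
  lookup-zipApply (φ ∷ φs) (y ∷ u) Fin.zero    = refl
  lookup-zipApply (φ ∷ φs) (y ∷ u) (Fin.suc a) = lookup-zipApply φs u a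

  *-+-< : ∀ {a m t n} → a < m → t < n → a * n + t < m * n
  *-+-< {a} {m} {t} {n} a<m t<n = begin-strict
    a * n + t   <⟨ +-monoʳ-< (a * n) t<n ⟩
    a * n + n   ≡⟨ +-comm (a * n) n ⟩
    suc a * n   ≤⟨ *-monoˡ-≤ n a<m ⟩
    m * n       ∎
    where open ≤-Reasoning

  permℕ : ∀ {n} → Perm n → ℕ → ℕ
  permℕ h = actℕ {m = 1} ((Fin.zero ∷ []) , (h ∷ []))

  permℕ-isPermBelow : ∀ {n} (h : Perm n) → LookupInjective h → IsPermBelow n (permℕ h)
  permℕ-isPermBelow {n} h h-inj =
    subst (λ z → IsPermBelow z (permℕ h)) (+-identityʳ n)
          (actℕ-isPermBelow ((Fin.zero ∷ []) , (h ∷ [])) ((λ { {Fin.zero} {Fin.zero} _ → refl }) , λ { Fin.zero → h-inj }))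

  -- In extend c σ the copy σ⁻¹(c) is sent to the last copy, which h then sends on to c;
  -- contracting the last copy composes the permutation of σ⁻¹(c) with h.
  twistAt : ∀ {n m} → Fin (suc m) → Perm n → Fin m → Perm n → Perm n
  twistAt c h t with inject₁ t ≟ᶠ c
  ... | yes _ = compose h
  ... | no _  = id

  twistAt-hit : ∀ {n m} (c : Fin (suc m)) (h : Perm n) t → inject₁ t ≡ c → ∀ v → twistAt c h t v ≡ compose h v
  twistAt-hit c h t t≡c v with inject₁ t ≟ᶠ c
  ... | yes _   = refl
  ... | no t≢c = ⊥-elim (t≢c t≡c)

  twistAt-miss : ∀ {n m} (c : Fin (suc m)) (h : Perm n) t → ¬ inject₁ t ≡ c → ∀ v → twistAt c h t v ≡ v
  twistAt-miss c h t t≢c v with inject₁ t ≟ᶠ c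
  ... | yes t≡c = ⊥-elim (t≢c t≡c)
  ... | no _    = refl

  topCycles : ∀ {n m} → Fin (suc m) → Perm n → ℕ
  topCycles {n} {m} c h with c ≟ᶠ fromℕ m
  ... | yes _ = cycleCount n (permℕ h)
  ... | no _  = 0

  topCycles-last : ∀ {n m} (h : Perm n) → topCycles (fromℕ m) h ≡ cycleCount n (permℕ h)
  topCycles-last {n} {m} h with fromℕ m ≟ᶠ fromℕ m
  ... | yes _ = refl
  ... | no ≢  = ⊥-elim (≢ refl)

  topCycles-¬last : ∀ {n m} (c : Fin (suc m)) (h : Perm n) → ¬ c ≡ fromℕ m → topCycles c h ≡ 0
  topCycles-¬last {n} {m} c h c≢ with c ≟ᶠ fromℕ m
  ... | yes c≡ = ⊥-elim (c≢ c≡)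
  ... | no _   = refl

  module _ {n m : ℕ} (c : Fin (suc m)) (σ : Perm m) (u : Vec (Perm n) m) (h : Perm n) where

    private
      g : Wreath n (suc m)
      g = extend c σ , (u ∷ʳ h)
      g′ : Wreath n m
      g′ = σ , zipApply (Vec.map (twistAt c h) σ) u
      M = m * n
      G = actℕ g

      key-inject₁ : ∀ a (j : Fin n) → key {n} {suc m} (inject₁ a , j) ≡ key {n} {m} (a , j)
      key-inject₁ a j = cong (λ z → z * n + toℕ j) (Fin.toℕ-inject₁ a)

      key-last : ∀ (j : Fin n) → key {n} {suc m} (fromℕ m , j) ≡ M + toℕ j
      key-last j = cong (λ z → z * n + toℕ j) (Fin.toℕ-fromℕ m)

      G-lower : ∀ a j → G (key {n} {m} (a , j)) ≡ key {n} {suc m} (reroute c (lookup σ a) , lookup (lookup u a) j)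
      G-lower a j = begin
        G (key (a , j))             ≡⟨ cong G (sym (key-inject₁ a j)) ⟩
        G (key (inject₁ a , j))     ≡⟨ actℕ-key g (inject₁ a , j) ⟩
        key (act g (inject₁ a , j)) ≡⟨ cong key (cong₂ _,_
                                         (trans (lookup-∷ʳ-inject₁ (Vec.map (reroute c) σ) c a) (Vec.lookup-map a (reroute c) σ))
                                         (cong (λ w → lookup w j) (lookup-∷ʳ-inject₁ u h a))) ⟩
        key (reroute c (lookup σ a) , lookup (lookup u a) j) ∎
        where open ≡-Reasoning

      G-top : ∀ j → G (M + toℕ j) ≡ key {n} {suc m} (c , lookup h j)
      G-top j = begin
        G (M + toℕ j)               ≡⟨ cong G (sym (key-last j)) ⟩
        G (key (fromℕ m , j))       ≡⟨ actℕ-key g (fromℕ m , j) ⟩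
        key (act g (fromℕ m , j))   ≡⟨ cong key (cong₂ _,_ (lookup-∷ʳ-fromℕ (Vec.map (reroute c) σ) c)
                                                           (cong (λ w → lookup w j) (lookup-∷ʳ-fromℕ u h))) ⟩
        key (c , lookup h j)        ∎
        where open ≡-Reasoning

      actℕ-g′-key : ∀ a j → actℕ g′ (key {n} {m} (a , j)) ≡ key {n} {m} (lookup σ a , lookup (twistAt c h (lookup σ a) (lookup u a)) j)
      actℕ-g′-key a j = trans (actℕ-key g′ (a , j)) (cong (λ w → key {n} {m} (lookup σ a , lookup w j))
        (trans (lookup-zipApply (Vec.map (twistAt c h) σ) u a) (cong (λ φ → φ (lookup u a)) (Vec.lookup-map a (twistAt c h) σ))))

      contracted-key : ∀ a j → contractAbove M n G (key {n} {m} (a , j)) ≡ actℕ g′ (key {n} {m} (a , j))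
      contracted-key a j with inject₁ (lookup σ a) ≟ᶠ c
      ... | yes σa≡c = trans (contractAbove-shortcut M n G x M≤Gx Gx<M+n G²x<M) (trans G²x≡ (sym (trans (actℕ-g′-key a j)
                         (cong (λ w → key {n} {m} (lookup σ a , w))
                               (trans (cong (λ w → lookup w j) (twistAt-hit c h _ σa≡c (lookup u a)))
                                      (Vec.lookup-map j (lookup h) (lookup u a)))))))
        where
        x = key {n} {m} (a , j)
        t = lookup (lookup u a) j
        Gx≡ : G x ≡ M + toℕ t
        Gx≡ = trans (G-lower a j) (trans (cong (λ z → key {n} {suc m} (z , t)) (reroute-hit c (lookup σ a) σa≡c)) (key-last t))
        M≤Gx : M ≤ G x
        M≤Gx = subst (M ≤_) (sym Gx≡) (m≤m+n M _)
        Gx<M+n : G x < M + n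
        Gx<M+n = subst (_< M + n) (sym Gx≡) (+-monoʳ-< M (Fin.toℕ<n t))
        G²x≡ : G (G x) ≡ key {n} {m} (lookup σ a , lookup h t)
        G²x≡ = trans (cong G Gx≡) (trans (G-top t)
                 (cong (λ z → z * n + toℕ (lookup h t)) (trans (cong toℕ (sym σa≡c)) (Fin.toℕ-inject₁ _))))
        G²x<M : G (G x) < M
        G²x<M = subst (_< M) (sym G²x≡) (key< {n} {m} (lookup σ a , lookup h t))
      ... | no σa≢c = trans (contractAbove-below M n G x Gx<M) (trans Gx≡ (sym (trans (actℕ-g′-key a j)
                        (cong (λ w → key {n} {m} (lookup σ a , lookup w j)) (twistAt-miss c h _ σa≢c (lookup u a))))))
        where
        x = key {n} {m} (a , j)
        t = lookup (lookup u a) j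
        Gx≡ : G x ≡ key {n} {m} (lookup σ a , t)
        Gx≡ = trans (G-lower a j) (trans (cong (λ z → key {n} {suc m} (z , t)) (reroute-miss c (lookup σ a) σa≢c))
                                         (key-inject₁ (lookup σ a) t))
        Gx<M : G x < M
        Gx<M = subst (_< M) (sym Gx≡) (key< {n} {m} (lookup σ a , t))

      top-shifted : c ≡ fromℕ m → ∀ y → y < n → G (M + y) ≡ M + permℕ h y
      top-shifted c≡last y y<n = begin
        G (M + y)                        ≡⟨ cong (λ z → G (M + z)) (sym (Fin.toℕ-fromℕ< y<n)) ⟩
        G (M + toℕ j)                    ≡⟨ G-top j ⟩
        toℕ c * n + toℕ (lookup h j)     ≡⟨ cong (λ z → z * n + toℕ (lookup h j)) (trans (cong toℕ c≡last) (Fin.toℕ-fromℕ m)) ⟩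
        M + toℕ (lookup h j)             ≡⟨ cong (λ z → M + z) (sym (trans (cong (permℕ h) (sym (Fin.toℕ-fromℕ< y<n)))
                                                                           (actℕ-key _ (Fin.zero , j)))) ⟩
        M + permℕ h y                    ∎
        where
        open ≡-Reasoning
        j = fromℕ< y<n

    cycleCount-extend : WellFormed g → WellFormed g′ → LookupInjective h →
                        cycleCount (suc m * n) (actℕ g) ≡ cycleCount (m * n) (actℕ g′) + topCycles c h
    cycleCount-extend g-wf g′-wf h-inj = begin
        cycleCount (n + M) G
      ≡⟨ cong (λ z → cycleCount z G) (+-comm n M) ⟩
        cycleCount (M + n) G
      ≡⟨ cycleCount-split M n G (subst (λ z → IsPermBelow z G) (+-comm n M) (actℕ-isPermBelow g g-wf)) ⟩
        cycleCount M (contractAbove M n G) + cyclesAbove M n G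
      ≡⟨ cong₂ _+_ (sym (cycleCount-cong (actℕ-isPermBelow g′ g′-wf) contracted)) cyclesAbove≡topCycles ⟩
        cycleCount M (actℕ g′) + topCycles c h
      ∎
      where
      open ≡-Reasoning
      contracted : ∀ {x} → x < M → actℕ g′ x ≡ contractAbove M n G x
      contracted {x} x<M = begin
        actℕ g′ x                       ≡⟨ cong (actℕ g′) (sym (key-decode {n} {m} x x<M)) ⟩
        actℕ g′ (key p)                 ≡⟨ sym (contracted-key (proj₁ p) (proj₂ p)) ⟩
        contractAbove M n G (key p)     ≡⟨ cong (contractAbove M n G) (key-decode {n} {m} x x<M) ⟩
        contractAbove M n G x           ∎
        where p = decode {n} {m} x<M
      cyclesAbove≡topCycles : cyclesAbove M n G ≡ topCycles c h
      cyclesAbove≡topCycles with c ≟ᶠ fromℕ m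
      ... | yes c≡last = trans (cyclesAbove-shift M n G (permℕ h) h-perm (top-shifted c≡last))
                               (sym (cycleCount≡cyclesAbove n (permℕ h) h-perm))
        where h-perm = permℕ-isPermBelow h h-inj
      ... | no c≢last = cyclesAbove-escaping M n G escape
        where
        c<m : toℕ c < m
        c<m = ≤∧≢⇒< (≤-pred (Fin.toℕ<n c)) (λ eq → c≢last (Fin.toℕ-injective (trans eq (sym (Fin.toℕ-fromℕ m)))))
        escape : ∀ y → M ≤ y → y < M + n → G y < M
        escape y M≤y y<M+n = subst (_< M) (sym Gy≡) (*-+-< c<m (Fin.toℕ<n _))
          where
          y∸M<n : y ∸ M < n
          y∸M<n = subst (y ∸ M <_) (m+n∸m≡n M n) (∸-monoˡ-< y<M+n M≤y)
          j = fromℕ< y∸M<n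
          Gy≡ : G y ≡ key {n} {suc m} (c , lookup h j)
          Gy≡ = trans (cong G (trans (sym (m+[n∸m]≡n M≤y)) (cong (λ z → M + z) (sym (Fin.toℕ-fromℕ< y∸M<n))))) (G-top j)

module Recursion where

  open import Data.Nat as ℕ using (ℕ; zero; suc)
  open import Data.Integer using (ℤ; 1ℤ; _+_; _*_; +_; _^_)
  open import Data.Integer.Properties using (*-comm; ^-distribˡ-+-*)
  open import Data.Fin as Fin using (Fin; fromℕ; inject₁)
  open import Data.Fin.Properties using () renaming (_≟_ to _≟ᶠ_)
  open import Data.List using (List; []; _∷_; map; concatMap; allFin)
  open import Data.List.Properties using (length-tabulate)
  open import Data.Vec as Vec using (Vec; []; _∷_; _∷ʳ_; lookup)
  import Data.Vec.Properties as Vec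
  open import Data.List.Relation.Unary.All as All using (All; []; _∷_)
  import Data.List.Relation.Unary.All.Properties as All
  open import Relation.Binary.PropositionalEquality
  open import Relation.Nullary using (yes; no)
  open import Data.Product using (_,_)
  open import Function using (_∘_; Equivalence)
  open CycleCount using (cycleCount)
  open IntegerSums
  open SymmetricGroup
  open Encoding using (actℕ; cycles≡cycleCount; LookupInjective; WellFormed)
  open TopCopy

  weight : ℤ → ∀ {n m} → Wreath n m → ℤ
  weight x {n} {m} g = x ^ cycleCount (m ℕ.* n) (actℕ g)

  fibreSum : ∀ n {m} → ℤ → Perm m → ℤ
  fibreSum n {m} x σ = ∑ (vecsFrom (symGroup n) m) (λ f → weight x (σ , f))

  cycleSum : ℕ → ℕ → ℤ → ℤ
  cycleSum n m x = ∑ (symGroup m) (fibreSum n x)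

  F-sym : ℕ → ℤ → ℤ
  F-sym n x = ∑ (symGroup n) (λ h → x ^ cycleCount n (permℕ h))

  order : ℕ → ℤ
  order n = ∑ (symGroup n) (λ _ → 1ℤ)

  F-wreath≡cycleSum : ∀ n m x → F-wreath n m x ≡ cycleSum n m x
  F-wreath≡cycleSum n m x = trans (∑-concatMap (symGroup m) _ _) (∑-cong (symGroup m) (λ σ →
    trans (∑-map (vecsFrom (symGroup n) m) (σ ,_) _)
          (∑-cong (vecsFrom (symGroup n) m) (λ f → cong (x ^_) (cycles≡cycleCount (σ , f))))))

  All-vecsFrom : ∀ {A : Set} {Q : A → Set} (xs : List A) k → All Q xs →
                 All (λ u → ∀ a → Q (lookup u a)) (vecsFrom xs k)
  All-vecsFrom xs zero    _   = (λ ()) ∷ []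
  All-vecsFrom {Q = Q} xs (suc k) all-q = extend-all (vecsFrom xs k) (All-vecsFrom xs k all-q)
    where
    extend-all : ∀ vs → All (λ u → ∀ a → Q (lookup u a)) vs →
                 All (λ u → ∀ a → Q (lookup u a)) (concatMap (λ v → map (_∷ v) xs) vs)
    extend-all []       []         = []
    extend-all (v ∷ vs) (qv ∷ qvs) =
      All.++⁺ (All.map⁺ (All.map (λ qa → λ { Fin.zero → qa ; (Fin.suc i) → qv i }) all-q)) (extend-all vs qvs)

  symGroup-distinct : ∀ n → All Distinct (symGroup n)
  symGroup-distinct n = All.all-filter distinct? (vecsFrom (allFin n) n)

  lookup-∷ʳ-all : ∀ {A : Set} {Q : A → Set} {k} (u : Vec A k) x → (∀ a → Q (lookup u a)) → Q x →
                  ∀ a → Q (lookup (u ∷ʳ x) a)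
  lookup-∷ʳ-all []      x _  qx Fin.zero    = qx
  lookup-∷ʳ-all (y ∷ u) x qu _  Fin.zero    = qu Fin.zero
  lookup-∷ʳ-all (y ∷ u) x qu qx (Fin.suc a) = lookup-∷ʳ-all u x (qu ∘ Fin.suc) qx a

  compose-injective : ∀ {n} (h v : Perm n) → LookupInjective h → LookupInjective v → LookupInjective (compose h v)
  compose-injective h v h-inj v-inj {i} {j} eq =
    v-inj (h-inj (trans (sym (Vec.lookup-map i (lookup h) v)) (trans eq (Vec.lookup-map j (lookup h) v))))

  twistAt-injective : ∀ {n m} (c : Fin (suc m)) (h : Perm n) t v → LookupInjective h → LookupInjective v →
                      LookupInjective (twistAt c h t v)
  twistAt-injective c h t v h-inj v-inj with inject₁ t ≟ᶠ c
  ... | yes _ = compose-injective h v h-inj v-inj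
  ... | no _  = v-inj

  ∑-symGroup-twistAt : ∀ {n m} (c : Fin (suc m)) (h : Perm n) → Distinct h → ∀ t →
                       SumInvariant (symGroup n) (twistAt c h t)
  ∑-symGroup-twistAt {n} c h dh t θ with inject₁ t ≟ᶠ c
  ... | yes _ = ∑-symGroup-compose n h dh θ
  ... | no _  = refl

  module _ {n m : ℕ} (x : ℤ) (c : Fin (suc m)) (σ : Perm m) (dσ : Distinct σ) (h : Perm n) (dh : Distinct h) where

    private
      twisted : Vec (Perm n) m → Vec (Perm n) m
      twisted = zipApply (Vec.map (twistAt c h) σ)

      lookup-twisted : ∀ u a → lookup (twisted u) a ≡ twistAt c h (lookup σ a) (lookup u a)
      lookup-twisted u a = trans (lookup-zipApply (Vec.map (twistAt c h) σ) u a)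
                                 (cong (λ φ → φ (lookup u a)) (Vec.lookup-map a (twistAt c h) σ))

    weight-extend : ∀ u → (∀ a → Distinct (lookup u a)) →
                    weight x (extend c σ , u ∷ʳ h) ≡ x ^ topCycles c h * weight x (σ , twisted u)
    weight-extend u du = begin
      x ^ cycleCount (suc m ℕ.* n) (actℕ (extend c σ , u ∷ʳ h))
        ≡⟨ cong (x ^_) (cycleCount-extend c σ u h extended-wf twisted-wf h-inj) ⟩
      x ^ (cycleCount (m ℕ.* n) (actℕ (σ , twisted u)) ℕ.+ topCycles c h)
        ≡⟨ ^-distribˡ-+-* x (cycleCount (m ℕ.* n) (actℕ (σ , twisted u))) (topCycles c h) ⟩
      weight x (σ , twisted u) * x ^ topCycles c h
        ≡⟨ *-comm (weight x (σ , twisted u)) _ ⟩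
      x ^ topCycles c h * weight x (σ , twisted u) ∎
      where
      open ≡-Reasoning
      h-inj = distinct⇒lookup-injective h dh
      u-inj : ∀ a → LookupInjective (lookup u a)
      u-inj a = distinct⇒lookup-injective (lookup u a) (du a)
      extended-wf : WellFormed (extend c σ , u ∷ʳ h)
      extended-wf = distinct⇒lookup-injective (extend c σ)
                      (Equivalence.from (distinct-map-∷ʳ⇔ (reroute c) (reroute-injective c) c (reroute≢ c) σ) dσ)
                  , lookup-∷ʳ-all {Q = LookupInjective} u h u-inj h-inj
      twisted-wf : WellFormed (σ , twisted u)
      twisted-wf = distinct⇒lookup-injective σ dσ
                 , λ a → subst LookupInjective (sym (lookup-twisted u a))
                               (twistAt-injective c h (lookup σ a) (lookup u a) h-inj (u-inj a))

    ∑-weight-twisted : ∑ (vecsFrom (symGroup n) m) (weight x ∘ (σ ,_) ∘ twisted) ≡ fibreSum n x σ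
    ∑-weight-twisted = ∑-vecsFrom-zipApply (symGroup n) m (Vec.map (twistAt c h) σ)
      (λ i → subst (SumInvariant (symGroup n)) (sym (Vec.lookup-map i (twistAt c h) σ))
                   (∑-symGroup-twistAt c h dh (lookup σ i)))
      (weight x ∘ (σ ,_))

  topFactor : ∀ n {m} → ℤ → Fin (suc m) → ℤ
  topFactor n x c = ∑ (symGroup n) (λ h → x ^ topCycles c h)

  fibreSum-extend : ∀ n {m} x (c : Fin (suc m)) (σ : Perm m) → Distinct σ →
                    fibreSum n x (extend c σ) ≡ topFactor n x c * fibreSum n x σ
  fibreSum-extend n {m} x c σ dσ = begin
    ∑ (vecsFrom S (suc m)) (λ f → weight x (extend c σ , f))
      ≡⟨ ∑-vecsFrom-∷ʳ S m _ ⟩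
    ∑ S (λ h → ∑ Fs (λ u → weight x (extend c σ , u ∷ʳ h)))
      ≡⟨ ∑-cong-All (All.map (λ {h} dh → ∑-cong-All (All.map (λ {u} du → weight-extend x c σ dσ h dh u du)
                                                            (All-vecsFrom S m (symGroup-distinct n))))
                             (symGroup-distinct n)) ⟩
    ∑ S (λ h → ∑ Fs (λ u → x ^ topCycles c h * weight x (σ , twisted h u)))
      ≡⟨ ∑-cong S (λ h → ∑-*ˡ Fs (x ^ topCycles c h) _) ⟩
    ∑ S (λ h → x ^ topCycles c h * ∑ Fs (λ u → weight x (σ , twisted h u)))
      ≡⟨ ∑-cong-All (All.map (λ {h} dh → cong (λ z → x ^ topCycles c h * z) (∑-weight-twisted x c σ dσ h dh))
                             (symGroup-distinct n)) ⟩
    ∑ S (λ h → x ^ topCycles c h * fibreSum n x σ)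
      ≡⟨ ∑-*ʳ S (λ h → x ^ topCycles c h) (fibreSum n x σ) ⟩
    topFactor n x c * fibreSum n x σ ∎
    where
    open ≡-Reasoning
    S = symGroup n
    Fs = vecsFrom S m
    twisted : Perm n → Vec (Perm n) m → Vec (Perm n) m
    twisted h = zipApply (Vec.map (twistAt c h) σ)

  ∑-topFactor : ∀ n m x → ∑ (allFin (suc m)) (topFactor n x) ≡ F-sym n x + + m * order n
  ∑-topFactor n m x = begin
    ∑ (allFin (suc m)) (topFactor n x)
      ≡⟨ ∑-allFin-reroute (fromℕ m) (topFactor n x) ⟩
    topFactor n x (fromℕ m) + ∑ (map (reroute (fromℕ m)) (allFin m)) (topFactor n x)
      ≡⟨ cong₂ _+_ (∑-cong S (λ h → cong (x ^_) (topCycles-last {m = m} h)))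
                   (trans (∑-map (allFin m) (reroute (fromℕ m)) (topFactor n x))
                          (∑-cong (allFin m) (λ j → ∑-cong S (λ h → cong (x ^_) (topCycles-¬last _ h (reroute≢ (fromℕ m) j)))))) ⟩
    F-sym n x + ∑ (allFin m) (λ _ → order n)
      ≡⟨ cong (λ z → F-sym n x + z) (trans (∑-const (allFin m) (order n)) (cong (λ z → + z * order n) (length-tabulate {n = m} (λ i → i)))) ⟩
    F-sym n x + + m * order n ∎
    where
    open ≡-Reasoning
    S = symGroup n

  cycleSum-suc : ∀ n m x → cycleSum n (suc m) x ≡ (F-sym n x + + m * order n) * cycleSum n m x
  cycleSum-suc n m x = begin
    ∑ (symGroup (suc m)) (fibreSum n x)
      ≡⟨ ∑-symGroup-suc m (fibreSum n x) ⟩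
    ∑ C (λ c → ∑ (symGroup m) (fibreSum n x ∘ extend c))
      ≡⟨ ∑-cong C (λ c → ∑-cong-All (All.map (fibreSum-extend n x c _) (symGroup-distinct m))) ⟩
    ∑ C (λ c → ∑ (symGroup m) (λ σ → topFactor n x c * fibreSum n x σ))
      ≡⟨ ∑-cong C (λ c → ∑-*ˡ (symGroup m) (topFactor n x c) (fibreSum n x)) ⟩
    ∑ C (λ c → topFactor n x c * cycleSum n m x)
      ≡⟨ ∑-*ʳ C (topFactor n x) (cycleSum n m x) ⟩
    ∑ C (topFactor n x) * cycleSum n m x
      ≡⟨ cong (_* cycleSum n m x) (∑-topFactor n m x) ⟩
    (F-sym n x + + m * order n) * cycleSum n m x ∎
    where
    open ≡-Reasoning
    C = allFin (suc m)

module RisingFactorial where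

  open import Data.Nat as ℕ using (ℕ; zero; suc; _<_)
  import Data.Nat.Properties as ℕ
  open import Data.Integer using (ℤ; 0ℤ; 1ℤ; -1ℤ; _+_; _*_; +_; -_; _^_)
  open import Data.Integer.Properties
  open import Data.Integer.Tactic.RingSolver using (solve-∀)
  open import Relation.Binary.PropositionalEquality
  open import Data.Product using (_,_)
  open import Data.Sum using (inj₁; inj₂)
  open ≡-Reasoning

  rising : ℕ → ℤ → ℤ
  rising zero    a = 1ℤ
  rising (suc n) a = (a + + n) * rising n a

  rising-suc-shift : ∀ n a → rising (suc n) a ≡ a * rising n (a + 1ℤ)
  rising-suc-shift zero    a = cong (_* 1ℤ) (+-identityʳ a)
  rising-suc-shift (suc n) a = begin
    (a + + suc n) * rising (suc n) a        ≡⟨ cong ((a + + suc n) *_) (rising-suc-shift n a) ⟩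
    (a + + suc n) * (a * rising n (a + 1ℤ)) ≡⟨ reassociate a (rising n (a + 1ℤ)) (+ n) ⟩
    a * ((a + 1ℤ + + n) * rising n (a + 1ℤ)) ∎
    where
    reassociate : ∀ a r b → (a + (1ℤ + b)) * (a * r) ≡ a * ((a + 1ℤ + b) * r)
    reassociate = solve-∀

  rising-neg : ∀ n → rising n (- + n) ≡ -1ℤ ^ n * rising n 1ℤ
  rising-neg zero    = refl
  rising-neg (suc n) = begin
    rising (suc n) (- + suc n)                   ≡⟨ rising-suc-shift n (- + suc n) ⟩
    - + suc n * rising n (- + suc n + 1ℤ)        ≡⟨ cong (λ z → - + suc n * rising n z) (-[1+n]+1≡-n n) ⟩
    - + suc n * rising n (- + n)                 ≡⟨ cong (- + suc n *_) (rising-neg n) ⟩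
    - + suc n * (-1ℤ ^ n * rising n 1ℤ)          ≡⟨ regroup (+ n) (-1ℤ ^ n) (rising n 1ℤ) ⟩
    (-1ℤ * -1ℤ ^ n) * ((1ℤ + + n) * rising n 1ℤ) ∎
    where
    -[1+n]+1≡-n : ∀ n → - + suc n + 1ℤ ≡ - + n
    -[1+n]+1≡-n zero    = refl
    -[1+n]+1≡-n (suc n) = refl
    regroup : ∀ b s r → - (1ℤ + b) * (s * r) ≡ (-1ℤ * s) * ((1ℤ + b) * r)
    regroup = solve-∀

  -1^odd : ∀ t → -1ℤ ^ suc (2 ℕ.* t) ≡ -1ℤ
  -1^odd zero    = refl
  -1^odd (suc t) = begin
    -1ℤ ^ suc (2 ℕ.* suc t)              ≡⟨ cong (λ z → -1ℤ ^ suc z) (ℕ.*-suc 2 t) ⟩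
    -1ℤ * (-1ℤ * -1ℤ ^ suc (2 ℕ.* t))    ≡⟨ cong (λ z → -1ℤ * (-1ℤ * z)) (-1^odd t) ⟩
    -1ℤ                                   ∎

  rising-root : ∀ n k → k < n → rising n (- + k) ≡ 0ℤ
  rising-root (suc n) k k<1+n with ℕ.m≤n⇒m<n∨m≡n (ℕ.≤-pred k<1+n)
  ... | inj₁ k<n  = trans (cong ((- + k + + n) *_) (rising-root n k k<n)) (*-zeroʳ (- + k + + n))
  ... | inj₂ refl = trans (cong (_* rising k (- + k)) (+-inverseˡ (+ k))) (*-zeroˡ (rising k (- + k)))

  rising-neg-odd : ∀ n → IsOdd n → rising n (- + n) + rising n 1ℤ ≡ 0ℤ
  rising-neg-odd n (t , refl) = begin
    rising n (- + n) + rising n 1ℤ            ≡⟨ cong (_+ rising n 1ℤ) (rising-neg n) ⟩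
    -1ℤ ^ n * rising n 1ℤ + rising n 1ℤ       ≡⟨ cong (λ s → s * rising n 1ℤ + rising n 1ℤ) (-1^odd t) ⟩
    -1ℤ * rising n 1ℤ + rising n 1ℤ           ≡⟨ cong (_+ rising n 1ℤ) (-1*i≡-i (rising n 1ℤ)) ⟩
    - rising n 1ℤ + rising n 1ℤ               ≡⟨ +-inverseˡ (rising n 1ℤ) ⟩
    0ℤ                                        ∎

module SymmetricPolynomial where

  open import Data.Nat as ℕ using (ℕ; zero; suc; _<_)
  import Data.Nat.Properties as ℕ
  open import Data.Integer using (1ℤ; _+_; _*_; +_; _^_)
  open import Data.Integer.Properties
  open import Data.Fin as Fin using (Fin; fromℕ<; toℕ)
  import Data.Fin.Properties as Fin
  open import Data.Vec using ([]; _∷_; lookup; replicate)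
  open import Data.List.Relation.Unary.All as All using ()
  open import Relation.Binary.PropositionalEquality
  open import Data.Product using (_,_)
  open CycleCount using (cycleCount; cycleCount-cong)
  open IntegerSums
  open SymmetricGroup using (Distinct; distinct⇒lookup-injective)
  open Encoding using (actℕ; actℕ-key)
  open TopCopy using (permℕ; permℕ-isPermBelow)
  open Recursion
  open RisingFactorial

  -- S_1 ≀ S_m is S_m acting on m points.
  permℕ≗actℕ-trivial : ∀ m (σ : Perm m) {x} → x < m → permℕ σ x ≡ actℕ (σ , replicate m (Fin.zero ∷ [])) x
  permℕ≗actℕ-trivial m σ {x} x<m = begin
    permℕ σ x                                   ≡⟨ cong (permℕ σ) (sym (Fin.toℕ-fromℕ< x<m)) ⟩
    permℕ σ (toℕ i)                             ≡⟨ actℕ-key _ (Fin.zero , i) ⟩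
    toℕ (lookup σ i)                            ≡⟨ sym (key-trivial (lookup σ i) (lookup (lookup ids i) Fin.zero)) ⟩
    key {1} {m} (lookup σ i , lookup (lookup ids i) Fin.zero) ≡⟨ sym (actℕ-key (σ , ids) (i , Fin.zero)) ⟩
    actℕ (σ , ids) (key {1} {m} (i , Fin.zero)) ≡⟨ cong (actℕ (σ , ids)) (trans (key-trivial i Fin.zero) (Fin.toℕ-fromℕ< x<m)) ⟩
    actℕ (σ , ids) x                            ∎
    where
    open ≡-Reasoning
    i = fromℕ< x<m
    ids = replicate m (Fin.zero ∷ [])
    key-trivial : ∀ a (z : Fin 1) → key {1} {m} (a , z) ≡ toℕ a
    key-trivial a Fin.zero = trans (ℕ.+-identityʳ (toℕ a ℕ.* 1)) (ℕ.*-identityʳ (toℕ a))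

  F-sym≡cycleSum-trivial : ∀ m x → F-sym m x ≡ cycleSum 1 m x
  F-sym≡cycleSum-trivial m x = ∑-cong-All (All.map (λ {σ} dσ → sym (trans
      (∑-vecsFrom-[ Fin.zero ∷ [] ] m (λ f → weight x (σ , f)))
      (cong (x ^_) (trans (cong (λ z → cycleCount z (actℕ (σ , replicate m (Fin.zero ∷ [])))) (ℕ.*-identityʳ m))
                          (sym (cycleCount-cong (permℕ-isPermBelow σ (distinct⇒lookup-injective σ dσ))
                                                (permℕ≗actℕ-trivial m σ)))))))
    (symGroup-distinct m))

  F-sym-one : ∀ x → F-sym 1 x ≡ x
  F-sym-one x = trans (+-identityʳ (x * 1ℤ)) (*-identityʳ x)

  cycleSum-trivial : ∀ m x → cycleSum 1 m x ≡ rising m x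
  cycleSum-trivial zero    x = refl
  cycleSum-trivial (suc m) x = trans (cycleSum-suc 1 m x)
    (cong₂ _*_ (cong₂ _+_ (F-sym-one x) (*-identityʳ (+ m))) (cycleSum-trivial m x))

  F-sym≡rising : ∀ n x → F-sym n x ≡ rising n x
  F-sym≡rising n x = trans (F-sym≡cycleSum-trivial n x) (cycleSum-trivial n x)

  order≡rising : ∀ n → order n ≡ rising n 1ℤ
  order≡rising n = trans (∑-cong (symGroup n) (λ h → sym (^-zeroˡ (cycleCount n (permℕ h))))) (F-sym≡rising n 1ℤ)

module Roots where

  open import Data.Nat as ℕ using (ℕ; suc; _≤_)
  import Data.Nat.Properties as ℕ
  open import Data.Integer using (0ℤ; _+_; _*_; +_; -_)
  open import Data.Integer.Properties using (*-zeroˡ; *-zeroʳ)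
  open import Data.Integer.Tactic.RingSolver using (solve-∀)
  open import Data.Sum using (_⊎_; inj₁; inj₂)
  open import Relation.Binary.PropositionalEquality
  open Recursion using (cycleSum; cycleSum-suc; F-sym; order)
  open RisingFactorial
  open SymmetricPolynomial

  cycleSum-two : ∀ n x → cycleSum n 2 x ≡ (F-sym n x + order n) * F-sym n x
  cycleSum-two n x = trans (cycleSum-suc n 1 x) (trans (cong (λ z → (F-sym n x + + 1 * order n) * z) (cycleSum-suc n 0 x))
                                                       (simplify (F-sym n x) (order n)))
    where
    simplify : ∀ f o → (f + + 1 * o) * ((f + + 0 * o) * + 1) ≡ (f + o) * f
    simplify = solve-∀

  cycleSum-root : ∀ n x → F-sym n x ≡ 0ℤ ⊎ F-sym n x + order n ≡ 0ℤ → ∀ j → cycleSum n (2 ℕ.+ j) x ≡ 0ℤ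
  cycleSum-root n x (inj₁ F≡0) ℕ.zero =
    trans (cycleSum-two n x) (trans (cong (λ z → (z + order n) * z) F≡0) (*-zeroʳ (0ℤ + order n)))
  cycleSum-root n x (inj₂ F+o≡0) ℕ.zero =
    trans (cycleSum-two n x) (trans (cong (_* F-sym n x) F+o≡0) (*-zeroˡ (F-sym n x)))
  cycleSum-root n x root (suc j) =
    trans (cycleSum-suc n (2 ℕ.+ j) x) (trans (cong (λ z → (F-sym n x + + (2 ℕ.+ j) * order n) * z) (cycleSum-root n x root j))
                                              (*-zeroʳ (F-sym n x + + (2 ℕ.+ j) * order n)))

  F-sym-root : ∀ n → IsOdd n → ∀ k → k ≤ n → F-sym n (- + k) ≡ 0ℤ ⊎ F-sym n (- + k) + order n ≡ 0ℤ
  F-sym-root n odd k k≤n with ℕ.m≤n⇒m<n∨m≡n k≤n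
  ... | inj₁ k<n  = inj₁ (trans (F-sym≡rising n (- + k)) (rising-root n k k<n))
  ... | inj₂ refl = inj₂ (trans (cong₂ _+_ (F-sym≡rising n (- + n)) (order≡rising n)) (rising-neg-odd n odd))

open import Data.Nat using (suc; s≤s)
open import Relation.Binary.PropositionalEquality using (trans)
open Recursion using (F-wreath≡cycleSum)
open Roots using (cycleSum-root; F-sym-root)

mainTheorem17 : (n m : ℕ) → IsOdd n → 1 < m → (k : ℕ) → 1 ≤ k → k ≤ n →
                  F-wreath n m (- (+ k)) ≡ 0ℤ
mainTheorem17 n (suc (suc j)) odd (s≤s (s≤s _)) k _ k≤n =
  trans (F-wreath≡cycleSum n (suc (suc j)) (- + k)) (cycleSum-root n (- + k) (F-sym-root n odd k k≤n) j)
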